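{- Let $\Lambda$ be a set of labels, and for each $\lambda\in\Lambda$ let $w_\lambda,y_\lambda,z_\lambda$ be elements of a field; let $x$ be an element of that field. Let $G=(V,E,c)$ be an edge-labeled finite multigraph with $c:E\to\Lambda$, and consider the recurrence relation $$\xi_{lab}(H)=w_{c(e)}\xi_{lab}(H_{ -e})+y_{c(e)}\xi_{lab}(H_{/e})+z_{c(e)}\xi_{lab}(H_{\dagger e})\ \text{(for every edge $e$ of $H$)},\quad \xi_{lab}(H_1\oplus H_2)=\xi_{lab}(H_1)\xi_{lab}(H_2),\quad \xi_{lab}(E_1)=x,\quad \xi_{lab}(\emptyset)=1.$$ Each of the following conditions is sufficient for this recurrence relation to be confluent: (1) $z_{c(e)}=0$ for all $e\in E$; (2) $w_{c(e)}=1$ for all $e\in E$, and $y_{c(e_1)}z_{c(e_2)}=y_{c(e_2)}z_{c(e_1)}$ for all $e_1,e_2\in E$.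
   Context: Multigraphs are finite, loops and multiple edges allowed; edges carry labels from $\Lambda$ (no algebraic structure on $\Lambda$), and edges keep their labels under the following operations. For an edge $e$: $H_{ -e}$ removes $e$; $H_{/e}$ identifies the endpoints of $e$ (removing $e$; may create loops and multiple edges); $H_{\dagger e}$ is the subgraph induced by $V\setminus\{u,v\}$ where $e=\{u,v\}$. $H_1\oplus H_2$ is disjoint union, $E_1$ the one-vertex edgeless graph, $\emptyset$ the graph with no vertices. The recurrence is confluent if evaluating $\xi_{lab}$ by repeatedly applying the rules in any order (any choice of edges to eliminate and of disjoint-union decompositions) always gives the same result. -}

module Defs where

open import Level using (Level; _⊔_) renaming (suc to lsuc)
open import Algebra.Bundles using (CommutativeRing)
open import Data.Bool using (Bool; true; false; if_then_else_; not; _∨_)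
open import Data.Nat using (ℕ; _≡ᵇ_)
open import Data.Fin using (Fin)
open import Data.List using (List; []; _∷_; [_]; length; removeAt; lookup)
open import Data.List.Membership.Propositional using (_∈_)
open import Data.List.Relation.Unary.All using (All)
open import Data.List.Relation.Unary.Unique.Propositional using (Unique)
open import Data.Product using (_×_; _,_; ∃)
open import Relation.Nullary using (¬_)
open import Relation.Binary.PropositionalEquality using (_≡_)

record Field (c ℓ : Level) : Set (lsuc (c ⊔ ℓ)) where
  field
    commutativeRing : CommutativeRing c ℓ
  open CommutativeRing commutativeRing public
  field
    0≉1     : ¬ (0# ≈ 1#)
    inverse : ∀ a → ¬ (a ≈ 0#) → ∃ λ b → a * b ≈ 1#

-- Vertices are named by natural numbers;
-- an edge is an (unordered) pair of endpoints together with its label.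
-- Loops (u = v) and repeated edges are allowed; the list of edges is a
-- multiset, and an individual edge is selected by its position in the list.
module _ (Λ : Set) where

  Edge : Set
  Edge = ℕ × ℕ × Λ

  record MGraph : Set where
    constructor mkG
    field
      verts : List ℕ
      edges : List Edge
  open MGraph public

  WF : MGraph → Set
  WF G = Unique (verts G) × All (λ { (u , v , _) → (u ∈ verts G) × (v ∈ verts G) }) (edges G)

  filterB : {A : Set} → (A → Bool) → List A → List A
  filterB p []       = []
  filterB p (a ∷ as) = if p a then a ∷ filterB p as else filterB p as

  del : (H : MGraph) → Fin (length (edges H)) → MGraph
  del H i = mkG (verts H) (removeAt (edges H) i)

  ren : ℕ → ℕ → ℕ → ℕ
  ren v u a = if a ≡ᵇ v then u else a

  renE : ℕ → ℕ → Edge → Edge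
  renE v u (a , b , l) = (ren v u a , ren v u b , l)

  mapL : {A B : Set} → (A → B) → List A → List B
  mapL f []       = []
  mapL f (a ∷ as) = f a ∷ mapL f as

  -- H_{/e} : identify the endpoints of edge number i (vertex v is merged into u)
  -- and remove the edge; for a loop this is just deletion.
  con : (H : MGraph) → Fin (length (edges H)) → MGraph
  con H i with lookup (edges H) i
  ... | (u , v , _) =
    if u ≡ᵇ v then del H i
    else mkG (filterB (λ a → not (a ≡ᵇ v)) (verts H))
             (mapL (renE v u) (removeAt (edges H) i))

  -- H_{†e} : subgraph induced by V ∖ {u , v}
  dag : (H : MGraph) → Fin (length (edges H)) → MGraph
  dag H i with lookup (edges H) i
  ... | (u , v , _) =
    mkG (filterB (λ a → not ((a ≡ᵇ u) ∨ (a ≡ᵇ v))) (verts H))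
        (filterB (λ { (a , b , _) → not ((a ≡ᵇ u) ∨ (a ≡ᵇ v) ∨ (b ≡ᵇ u) ∨ (b ≡ᵇ v)) })
                 (removeAt (edges H) i))

  part : (ℕ → Bool) → MGraph → MGraph
  part p H = mkG (filterB p (verts H)) (filterB (λ { (a , _ , _) → p a }) (edges H))

  -- p splits H as a disjoint union H = part p H ⊕ part (not ∘ p) H:
  -- no edge joins the two sides, and both sides are nonempty.
  record Splits (p : ℕ → Bool) (H : MGraph) : Set where
    field
      noCross : All (λ { (a , b , _) → p a ≡ p b }) (edges H)
      left≠∅  : ¬ (verts (part p H) ≡ [])
      right≠∅ : ¬ (verts (part (λ a → not (p a)) H) ≡ [])

-- Evaluations of ξ_lab: H ⇓ r means that some complete application of the
-- recurrence rules, in some order, evaluates H to r.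
module Eval {c ℓ} (F : Field c ℓ) (Λ : Set) (w y z : Λ → Field.Carrier F) (x : Field.Carrier F) where
  open Field F

  data _⇓_ : MGraph Λ → Carrier → Set (c ⊔ ℓ) where
    empty : mkG [] [] ⇓ 1#
    single : ∀ v → mkG [ v ] [] ⇓ x
    edge : ∀ H (i : Fin (length (edges H))) {a b d} →
           let (_ , _ , l) = lookup (edges H) i in
           del Λ H i ⇓ a → con Λ H i ⇓ b → dag Λ H i ⇓ d →
           H ⇓ ((w l * a + y l * b) + z l * d)
    union : ∀ H (p : ℕ → Bool) {a b} → Splits Λ p H →
            part Λ p H ⇓ a → part Λ (λ v → not (p v)) H ⇓ b →
            H ⇓ (a * b)

  Confluent : MGraph Λ → Set (c ⊔ ℓ)
  Confluent G = ∀ {a b} → G ⇓ a → G ⇓ b → a ≈ b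

module Submission where

-- Idea: fix one particular evaluation strategy and show that every evaluation
-- agrees with it.  The strategy eliminates the edges in list order; to describe
-- the intermediate graphs without rebuilding them, ξ n σ D L evaluates a "state"
-- of the original vertex names: σ records which vertices have been identified by
-- contractions, D which vertices have been deleted, n how many remain.

open import Defs
open import Level using (Level)
open import Data.List.Relation.Unary.All using (All)
open import Data.Product using (_×_; _,_)
open import Data.Sum using (_⊎_)

module VertexNames where

  open import Data.Nat using (ℕ; suc; _+_; _≡ᵇ_; _≟_)
  open import Data.Nat.Properties using (+-comm; +-suc)
  open import Data.Bool using (Bool; true; false; if_then_else_; _∨_)
  open import Data.Product using (proj₁; proj₂)
  open import Relation.Nullary using (¬_; proof)
  open import Relation.Nullary.Reflects using (Reflects; ofʸ; ofⁿ)
  open import Relation.Binary.PropositionalEquality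
  open import Data.Sum using (inj₁; inj₂; map₂)
  open import Data.Empty using (⊥-elim)

  -- the builtin test _≡ᵇ_ reflects equality (it is how _≟_ is implemented)
  ≡ᵇ-reflects : ∀ m n → Reflects (m ≡ n) (m ≡ᵇ n)
  ≡ᵇ-reflects m n = proof (m ≟ n)

  ≡ᵇ-true : ∀ {m n} → m ≡ n → (m ≡ᵇ n) ≡ true
  ≡ᵇ-true {m} {n} p with m ≡ᵇ n | ≡ᵇ-reflects m n
  ... | true  | _     = refl
  ... | false | ofⁿ q = ⊥-elim (q p)

  ≡ᵇ-false : ∀ {m n} → ¬ (m ≡ n) → (m ≡ᵇ n) ≡ false
  ≡ᵇ-false {m} {n} p with m ≡ᵇ n | ≡ᵇ-reflects m n
  ... | true  | ofʸ q = ⊥-elim (p q)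
  ... | false | _     = refl

  ≡ᵇ-sound : ∀ {m n} → (m ≡ᵇ n) ≡ true → m ≡ n
  ≡ᵇ-sound {m} {n} e with m ≡ᵇ n | ≡ᵇ-reflects m n
  ... | true | ofʸ q = q

  ≡ᵇ-cong : ∀ {m n p q} → (m ≡ n → p ≡ q) → (p ≡ q → m ≡ n) → (m ≡ᵇ n) ≡ (p ≡ᵇ q)
  ≡ᵇ-cong {m} {n} {p} {q} f g with m ≡ᵇ n | ≡ᵇ-reflects m n | p ≡ᵇ q | ≡ᵇ-reflects p q
  ... | true  | _     | true  | _     = refl
  ... | false | _     | false | _     = refl
  ... | true  | ofʸ a | false | ofⁿ b = ⊥-elim (b (f a))
  ... | false | ofⁿ a | true  | ofʸ b = ⊥-elim (a (g b))

  bool-ext : ∀ {b b' : Bool} → (b ≡ true → b' ≡ true) → (b' ≡ true → b ≡ true) → b ≡ b'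
  bool-ext {true}  {true}  f g = refl
  bool-ext {false} {false} f g = refl
  bool-ext {true}  {false} f g = sym (f refl)
  bool-ext {false} {true}  f g = g refl

  true-or-false : (b : Bool) → b ≡ true ⊎ b ≡ false
  true-or-false true  = inj₁ refl
  true-or-false false = inj₂ refl

  ∨-true : ∀ {a b : Bool} → (a ∨ b) ≡ true → a ≡ true ⊎ b ≡ true
  ∨-true {true}  e = inj₁ refl
  ∨-true {false} e = inj₂ e

  ∨-trueˡ : ∀ {a} b → a ≡ true → (a ∨ b) ≡ true
  ∨-trueˡ b refl = refl

  ∨-trueʳ : ∀ a {b} → b ≡ true → (a ∨ b) ≡ true
  ∨-trueʳ true  e = refl
  ∨-trueʳ false e = e

  ∨-false : ∀ {a b : Bool} → (a ∨ b) ≡ false → a ≡ false × b ≡ false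
  ∨-false {false} {false} e = refl , refl

  rename : ℕ → ℕ → ℕ → ℕ
  rename v u t = if t ≡ᵇ v then u else t

  rename-old : ∀ v u → rename v u v ≡ u
  rename-old v u rewrite ≡ᵇ-true {v} {v} refl = refl

  rename-new : ∀ v u → rename v u u ≡ u
  rename-new v u with u ≡ᵇ v
  ... | true  = refl
  ... | false = refl

  rename-other : ∀ {v u t} → ¬ (t ≡ v) → rename v u t ≡ t
  rename-other p rewrite ≡ᵇ-false p = refl

  rename-self : ∀ u t → rename u u t ≡ t
  rename-self u t with t ≡ᵇ u | ≡ᵇ-reflects t u
  ... | true  | ofʸ p = sym p
  ... | false | _     = refl

  OneOf : ℕ → ℕ → ℕ → Set
  OneOf A B X = X ≡ A ⊎ X ≡ B

  rename-kernel : ∀ {B A X Y} → rename B A X ≡ rename B A Y → X ≡ Y ⊎ (OneOf A B X × OneOf A B Y)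
  rename-kernel {B} {A} {X} {Y} e with X ≡ᵇ B | ≡ᵇ-reflects X B | Y ≡ᵇ B | ≡ᵇ-reflects Y B
  ... | true  | ofʸ xb | true  | ofʸ yb = inj₁ (trans xb (sym yb))
  ... | true  | ofʸ xb | false | _      = inj₂ (inj₂ xb , inj₁ (sym e))
  ... | false | _      | true  | ofʸ yb = inj₂ (inj₁ e , inj₂ yb)
  ... | false | _      | false | _      = inj₁ e

  rename-oneOf : ∀ {B A X} → OneOf A B X → rename B A X ≡ A
  rename-oneOf {B} {A} (inj₁ refl) = rename-new B A
  rename-oneOf {B} {A} (inj₂ refl) = rename-old B A

  rename-factor : ∀ {A B} (ψ : ℕ → ℕ) → ψ A ≡ ψ B → ∀ X Y → rename B A X ≡ rename B A Y → ψ X ≡ ψ Y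
  rename-factor {A} {B} ψ ψAB X Y e with rename-kernel {B} {A} {X} {Y} e
  ... | inj₁ p          = cong ψ p
  ... | inj₂ (xi , yi) = trans (toA X xi) (sym (toA Y yi))
    where
    toA : ∀ Z → OneOf A B Z → ψ Z ≡ ψ A
    toA Z (inj₁ refl) = refl
    toA Z (inj₂ refl) = sym ψAB

  -- contracting two edges AB and then CE, in this order
  merge₂ : ℕ → ℕ → ℕ → ℕ → ℕ → ℕ
  merge₂ A B C E t = rename (rename B A E) (rename B A C) (rename B A t)

  merge₂-factor : ∀ A B C E (ψ : ℕ → ℕ) → ψ A ≡ ψ B → ψ C ≡ ψ E →
                  ∀ X Y → merge₂ A B C E X ≡ merge₂ A B C E Y → ψ X ≡ ψ Y
  merge₂-factor A B C E ψ ψAB ψCE X Y e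
    with rename-kernel {rename B A E} {rename B A C} {rename B A X} {rename B A Y} e
  ... | inj₁ p          = rename-factor ψ ψAB X Y p
  ... | inj₂ (xi , yi) = trans (toC X xi) (sym (toC Y yi))
    where
    toC : ∀ Z → OneOf (rename B A C) (rename B A E) (rename B A Z) → ψ Z ≡ ψ C
    toC Z (inj₁ e') = rename-factor ψ ψAB Z C e'
    toC Z (inj₂ e') = trans (rename-factor ψ ψAB Z E e') (sym ψCE)

  merge₂-swap : ∀ A B C E X Y → merge₂ A B C E X ≡ merge₂ A B C E Y → merge₂ C E A B X ≡ merge₂ C E A B Y
  merge₂-swap A B C E = merge₂-factor A B C E (merge₂ C E A B) identAB identCE
    where
    identAB : merge₂ C E A B A ≡ merge₂ C E A B B
    identAB = trans (rename-new (rename E C B) (rename E C A)) (sym (rename-old (rename E C B) (rename E C A)))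
    identCE : merge₂ C E A B C ≡ merge₂ C E A B E
    identCE = cong (rename (rename E C B) (rename E C A)) (trans (rename-new E C) (sym (rename-old E C)))

  -- number of vertices lost by contracting an edge with endpoints p, q (none for a loop)
  contractLoss : ℕ → ℕ → ℕ
  contractLoss p q = if p ≡ᵇ q then 0 else 1

  -- number of vertices lost by deleting both endpoints p, q
  deleteLoss : ℕ → ℕ → ℕ
  deleteLoss p q = if p ≡ᵇ q then 1 else 2

  deleteLoss≡suc : ∀ p q → deleteLoss p q ≡ suc (contractLoss p q)
  deleteLoss≡suc p q with p ≡ᵇ q
  ... | true  = refl
  ... | false = refl

  contractLoss-cong : ∀ {p q p' q'} → (p ≡ q → p' ≡ q') → (p' ≡ q' → p ≡ q) →
                      contractLoss p q ≡ contractLoss p' q'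
  contractLoss-cong f g rewrite ≡ᵇ-cong f g = refl

  contractLoss-loop : ∀ p → contractLoss p p ≡ 0
  contractLoss-loop p rewrite ≡ᵇ-true {p} {p} refl = refl

  -- if C ≠ E become equal after merging B into A then {C , E} = {A , B},
  -- so A and B become equal after merging E into C
  merged-together : ∀ {A B C E} → ¬ (C ≡ E) → rename B A C ≡ rename B A E → rename E C A ≡ rename E C B
  merged-together {A} {B} {C} {E} ne e with rename-kernel {B} {A} {C} {E} e
  ... | inj₁ p          = ⊥-elim (ne p)
  ... | inj₂ (ci , ei) = trans (rename-oneOf (proj₁ (swap ci ei))) (sym (rename-oneOf (proj₂ (swap ci ei))))
    where
    swap : OneOf A B C → OneOf A B E → OneOf C E A × OneOf C E B
    swap (inj₁ refl) (inj₁ refl) = ⊥-elim (ne refl)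
    swap (inj₁ refl) (inj₂ refl) = inj₁ refl , inj₂ refl
    swap (inj₂ refl) (inj₁ refl) = inj₂ refl , inj₁ refl
    swap (inj₂ refl) (inj₂ refl) = ⊥-elim (ne refl)

  contractLoss-swap : ∀ A B C E → contractLoss A B + contractLoss (rename B A C) (rename B A E)
                                ≡ contractLoss C E + contractLoss (rename E C A) (rename E C B)
  contractLoss-swap A B C E with A ≡ᵇ B | ≡ᵇ-reflects A B
  ... | true | ofʸ refl
    rewrite rename-self A C | rename-self A E | contractLoss-loop (rename E C A) | +-comm (contractLoss C E) 0 = refl
  ... | false | ofⁿ ab with C ≡ᵇ E | ≡ᵇ-reflects C E
  ... | true | ofʸ refl rewrite rename-self C A | rename-self C B | contractLoss-loop (rename B A C) | ≡ᵇ-false ab = refl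
  ... | false | ofⁿ ce = cong suc (contractLoss-cong (merged-together ce) (merged-together ab))

  contract-delete-loss-swap : ∀ A B C E → contractLoss A B + deleteLoss (rename B A C) (rename B A E)
                                        ≡ contractLoss C E + deleteLoss (rename E C A) (rename E C B)
  contract-delete-loss-swap A B C E
    rewrite deleteLoss≡suc (rename B A C) (rename B A E) | deleteLoss≡suc (rename E C A) (rename E C B)
          | +-suc (contractLoss A B) (contractLoss (rename B A C) (rename B A E))
          | +-suc (contractLoss C E) (contractLoss (rename E C A) (rename E C B)) = cong suc (contractLoss-swap A B C E)

  oneOfᵇ : ℕ → ℕ → ℕ → Bool
  oneOfᵇ X A B = (X ≡ᵇ A) ∨ (X ≡ᵇ B)

  oneOfᵇ-sound : ∀ {X A B} → oneOfᵇ X A B ≡ true → OneOf A B X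
  oneOfᵇ-sound {X} {A} {B} e with ∨-true {X ≡ᵇ A} e
  ... | inj₁ p = inj₁ (≡ᵇ-sound p)
  ... | inj₂ p = inj₂ (≡ᵇ-sound p)

  oneOfᵇ-complete : ∀ {X A B} → OneOf A B X → oneOfᵇ X A B ≡ true
  oneOfᵇ-complete {X} {A} {B} (inj₁ p) = ∨-trueˡ (X ≡ᵇ B) (≡ᵇ-true p)
  oneOfᵇ-complete {X} {A} {B} (inj₂ p) = ∨-trueʳ (X ≡ᵇ A) (≡ᵇ-true p)

  oneOfᵇ-false : ∀ {X A B} → oneOfᵇ X A B ≡ false → ¬ OneOf A B X
  oneOfᵇ-false e i with trans (sym e) (oneOfᵇ-complete i)
  ... | ()

  meetsᵇ : ℕ → ℕ → ℕ → ℕ → Bool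
  meetsᵇ A B C E = oneOfᵇ C A B ∨ oneOfᵇ E A B

  meetsᵇ-sym : ∀ A B C E → meetsᵇ A B C E ≡ meetsᵇ C E A B
  meetsᵇ-sym A B C E = bool-ext (meets→ {A} {B} {C} {E}) (meets→ {C} {E} {A} {B})
    where
    meets→ : ∀ {A B C E} → meetsᵇ A B C E ≡ true → meetsᵇ C E A B ≡ true
    meets→ {A} {B} {C} {E} e with ∨-true {oneOfᵇ C A B} e
    ... | inj₁ p with oneOfᵇ-sound {C} {A} {B} p
    ... | inj₁ refl = ∨-trueˡ (oneOfᵇ B C E) (oneOfᵇ-complete {A} {C} {E} (inj₁ refl))
    ... | inj₂ refl = ∨-trueʳ (oneOfᵇ A C E) (oneOfᵇ-complete {B} {C} {E} (inj₁ refl))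
    meets→ {A} {B} {C} {E} e | inj₂ p with oneOfᵇ-sound {E} {A} {B} p
    ... | inj₁ refl = ∨-trueˡ (oneOfᵇ B C E) (oneOfᵇ-complete {A} {C} {E} (inj₂ refl))
    ... | inj₂ refl = ∨-trueʳ (oneOfᵇ A C E) (oneOfᵇ-complete {B} {C} {E} (inj₂ refl))

  Meets : ℕ → ℕ → ℕ → ℕ → Set
  Meets A B C E = OneOf A B C ⊎ OneOf A B E

  meetsᵇ-sound : ∀ {A B C E} → meetsᵇ A B C E ≡ true → Meets A B C E
  meetsᵇ-sound {A} {B} {C} {E} e with ∨-true {oneOfᵇ C A B} e
  ... | inj₁ p = inj₁ (oneOfᵇ-sound {C} {A} {B} p)
  ... | inj₂ p = inj₂ (oneOfᵇ-sound {E} {A} {B} p)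

  meetsᵇ-complete : ∀ {A B C E} → Meets A B C E → meetsᵇ A B C E ≡ true
  meetsᵇ-complete {A} {B} {C} {E} (inj₁ i) = ∨-trueˡ (oneOfᵇ E A B) (oneOfᵇ-complete {C} {A} {B} i)
  meetsᵇ-complete {A} {B} {C} {E} (inj₂ i) = ∨-trueʳ (oneOfᵇ C A B) (oneOfᵇ-complete {E} {A} {B} i)

  meetsᵇ-false : ∀ {A B C E} → meetsᵇ A B C E ≡ false → ¬ OneOf A B C × ¬ OneOf A B E
  meetsᵇ-false {A} {B} {C} {E} e =
    oneOfᵇ-false {C} {A} {B} (proj₁ (∨-false {oneOfᵇ C A B} e)) , oneOfᵇ-false {E} {A} {B} (proj₂ (∨-false {oneOfᵇ C A B} e))

  Meets-sym : ∀ {A B C E} → Meets A B C E → Meets C E A B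
  Meets-sym {A} {B} {C} {E} m = meetsᵇ-sound (trans (sym (meetsᵇ-sym A B C E)) (meetsᵇ-complete m))

  rename-≡ᵇ-outside : ∀ {A B C} X → ¬ OneOf A B C → (rename B A X ≡ᵇ rename B A C) ≡ (X ≡ᵇ C)
  rename-≡ᵇ-outside {A} {B} {C} X n = ≡ᵇ-cong unmerge (cong (rename B A))
    where
    unmerge : rename B A X ≡ rename B A C → X ≡ C
    unmerge e with rename-kernel {B} {A} {X} {C} e
    ... | inj₁ p        = p
    ... | inj₂ (_ , ci) = ⊥-elim (n ci)

  rename-hits-meeting : ∀ {A B C E} X → Meets A B C E →
    ((rename B A X ≡ᵇ rename B A C) ∨ (rename B A X ≡ᵇ rename B A E)) ≡ (oneOfᵇ X A B ∨ oneOfᵇ X C E)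
  rename-hits-meeting {A} {B} {C} {E} X meet = bool-ext hits→ hits←
    where
    hitsOne : ∀ {Z} → rename B A X ≡ rename B A Z → OneOf A B X ⊎ X ≡ Z
    hitsOne {Z} e with rename-kernel {B} {A} {X} {Z} e
    ... | inj₁ p        = inj₂ p
    ... | inj₂ (xi , _) = inj₁ xi
    inUnion : OneOf A B X ⊎ OneOf C E X → (oneOfᵇ X A B ∨ oneOfᵇ X C E) ≡ true
    inUnion (inj₁ i) = ∨-trueˡ (oneOfᵇ X C E) (oneOfᵇ-complete i)
    inUnion (inj₂ i) = ∨-trueʳ (oneOfᵇ X A B) (oneOfᵇ-complete i)
    hits→ : ((rename B A X ≡ᵇ rename B A C) ∨ (rename B A X ≡ᵇ rename B A E)) ≡ true →
            (oneOfᵇ X A B ∨ oneOfᵇ X C E) ≡ true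
    hits→ e with ∨-true {rename B A X ≡ᵇ rename B A C} e
    ... | inj₁ p = inUnion (map₂ inj₁ (hitsOne (≡ᵇ-sound p)))
    ... | inj₂ p = inUnion (map₂ inj₂ (hitsOne (≡ᵇ-sound p)))
    toImage : OneOf A B X → Meets A B C E →
              ((rename B A X ≡ᵇ rename B A C) ∨ (rename B A X ≡ᵇ rename B A E)) ≡ true
    toImage xi (inj₁ ci) = ∨-trueˡ (rename B A X ≡ᵇ rename B A E) (≡ᵇ-true (trans (rename-oneOf xi) (sym (rename-oneOf ci))))
    toImage xi (inj₂ ei) = ∨-trueʳ (rename B A X ≡ᵇ rename B A C) (≡ᵇ-true (trans (rename-oneOf xi) (sym (rename-oneOf ei))))
    hits← : (oneOfᵇ X A B ∨ oneOfᵇ X C E) ≡ true →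
            ((rename B A X ≡ᵇ rename B A C) ∨ (rename B A X ≡ᵇ rename B A E)) ≡ true
    hits← e with ∨-true {oneOfᵇ X A B} e
    ... | inj₁ q = toImage (oneOfᵇ-sound q) meet
    ... | inj₂ q with oneOfᵇ-sound {X} {C} {E} q
    ... | inj₁ refl = ∨-trueˡ (rename B A X ≡ᵇ rename B A E) (≡ᵇ-true {rename B A X} refl)
    ... | inj₂ refl = ∨-trueʳ (rename B A X ≡ᵇ rename B A C) (≡ᵇ-true {rename B A X} refl)

module ListFacts (Λ : Set) where

  open VertexNames using (≡ᵇ-true; ≡ᵇ-false)
  open import Data.Nat using (ℕ; suc; _+_; _≡ᵇ_; _≤_; z≤n; s≤s)
  open import Data.Nat.Properties using (m≤n⇒m≤1+n; +-suc)
  open import Data.Bool using (Bool; true; false; not; _∧_)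
  open import Data.Bool.Properties using (∧-comm)
  open import Data.List using (List; []; _∷_; length; removeAt; lookup)
  open import Data.List.Relation.Unary.All as All using (All; []; _∷_)
  open import Data.List.Relation.Unary.Any using (here; there)
  open import Data.List.Membership.Propositional using (_∈_)
  open import Data.List.Relation.Unary.Unique.Propositional using (Unique)
  open import Data.List.Relation.Unary.AllPairs using ([]; _∷_)
  open import Data.List.Relation.Binary.Permutation.Propositional as Perm using (_↭_)
  open import Data.Fin using (zero; suc)
  open import Relation.Nullary using (¬_)
  open import Relation.Binary.PropositionalEquality

  filt : {A : Set} → (A → Bool) → List A → List A
  filt = filterB Λ

  mapList : {A B : Set} → (A → B) → List A → List B
  mapList = mapL Λ

  filt-keep : ∀ {A : Set} {p : A → Bool} {a : A} as → p a ≡ true → filt p (a ∷ as) ≡ a ∷ filt p as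
  filt-keep {p = p} {a} as h with p a | h
  ... | true | refl = refl

  filt-drop : ∀ {A : Set} {p : A → Bool} {a : A} as → p a ≡ false → filt p (a ∷ as) ≡ filt p as
  filt-drop {p = p} {a} as h with p a | h
  ... | false | refl = refl

  filt-cong : ∀ {A : Set} {p q : A → Bool} as → All (λ a → p a ≡ q a) as → filt p as ≡ filt q as
  filt-cong []       []       = refl
  filt-cong (a ∷ as) (e ∷ es) rewrite e | filt-cong as es = refl

  filt-ext : ∀ {A : Set} {p q : A → Bool} → (∀ a → p a ≡ q a) → ∀ as → filt p as ≡ filt q as
  filt-ext h as = filt-cong as (All.universal h as)

  filt-filt : ∀ {A : Set} (p q : A → Bool) as → filt p (filt q as) ≡ filt (λ a → q a ∧ p a) as
  filt-filt p q [] = refl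
  filt-filt p q (a ∷ as) with q a
  ... | false = filt-filt p q as
  ... | true with p a
  ... | true  = cong (a ∷_) (filt-filt p q as)
  ... | false = filt-filt p q as

  filt-comm : ∀ {A : Set} (p q : A → Bool) as → filt p (filt q as) ≡ filt q (filt p as)
  filt-comm p q as =
    trans (filt-filt p q as) (trans (filt-ext (λ a → ∧-comm (q a) (p a)) as) (sym (filt-filt q p as)))

  filt-all : ∀ {A : Set} {p : A → Bool} as → All (λ a → p a ≡ true) as → filt p as ≡ as
  filt-all []       []       = refl
  filt-all {p = p} (a ∷ as) (e ∷ es) = trans (filt-keep as e) (cong (a ∷_) (filt-all as es))

  All-filt-kept : ∀ {A : Set} {p : A → Bool} {Q : A → Set} as → All (λ a → p a ≡ true → Q a) as → All Q (filt p as)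
  All-filt-kept [] [] = []
  All-filt-kept {p = p} (a ∷ as) (h ∷ hs) with p a
  ... | true  = h refl ∷ All-filt-kept as hs
  ... | false = All-filt-kept as hs

  All-filt : ∀ {A : Set} {p : A → Bool} {Q : A → Set} as → All Q as → All Q (filt p as)
  All-filt as hs = All-filt-kept as (All.map (λ q _ → q) hs)

  ∈-filt : ∀ {A : Set} {p : A → Bool} {v : A} {as} → v ∈ as → p v ≡ true → v ∈ filt p as
  ∈-filt {p = p} {as = a ∷ as} (here refl) e rewrite e = here refl
  ∈-filt {p = p} {as = a ∷ as} (there m) e with p a
  ... | true  = there (∈-filt m e)
  ... | false = ∈-filt m e

  Unique-filt : ∀ {A : Set} {p : A → Bool} {as : List A} → Unique as → Unique (filt p as)
  Unique-filt {as = []} [] = []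
  Unique-filt {p = p} {as = a ∷ as} (h ∷ u) with p a
  ... | true  = All-filt as h ∷ Unique-filt u
  ... | false = Unique-filt u

  All-mapList : ∀ {A B : Set} {P : A → Set} {Q : B → Set} {f : A → B} →
                (∀ {a} → P a → Q (f a)) → ∀ {as} → All P as → All Q (mapList f as)
  All-mapList h []       = []
  All-mapList h (p ∷ ps) = h p ∷ All-mapList h ps

  filt-mapList : ∀ {A B : Set} {p : B → Bool} {q : A → Bool} {f : A → B} →
                 (∀ a → p (f a) ≡ q a) → ∀ as → filt p (mapList f as) ≡ mapList f (filt q as)
  filt-mapList h [] = refl
  filt-mapList {q = q} {f} h (a ∷ as) rewrite h a with q a
  ... | true  = cong (f a ∷_) (filt-mapList h as)
  ... | false = filt-mapList h as

  mapList-id : ∀ {A : Set} {f : A → A} as → All (λ a → f a ≡ a) as → mapList f as ≡ as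
  mapList-id []       []       = refl
  mapList-id (a ∷ as) (e ∷ es) = cong₂ _∷_ e (mapList-id as es)

  length-mapList : ∀ {A B : Set} {f : A → B} as → length (mapList f as) ≡ length as
  length-mapList []       = refl
  length-mapList (a ∷ as) = cong suc (length-mapList as)

  length-filt : ∀ {A : Set} {p : A → Bool} as → length (filt p as) ≤ length as
  length-filt [] = z≤n
  length-filt {p = p} (a ∷ as) with p a
  ... | true  = s≤s (length-filt as)
  ... | false = m≤n⇒m≤1+n (length-filt as)

  length-filt-split : ∀ {A : Set} (p q : A → Bool) → (∀ a → q a ≡ not (p a)) → ∀ as →
                      length (filt p as) + length (filt q as) ≡ length as
  length-filt-split p q h [] = refl
  length-filt-split p q h (a ∷ as) rewrite h a with p a
  ... | true  = cong suc (length-filt-split p q h as)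
  ... | false = trans (+-suc (length (filt p as)) (length (filt q as))) (cong suc (length-filt-split p q h as))

  All-≢-∈ : ∀ {A : Set} {a v : A} {as} → All (λ b → ¬ (a ≡ b)) as → v ∈ as → ¬ (a ≡ v)
  All-≢-∈ (n ∷ _)  (here refl) = n
  All-≢-∈ (_ ∷ ns) (there m)   = All-≢-∈ ns m

  length-remove : ∀ (vs : List ℕ) v → Unique vs → v ∈ vs → suc (length (filt (λ a → not (a ≡ᵇ v)) vs)) ≡ length vs
  length-remove (a ∷ vs) v (h ∷ u) (here refl) rewrite ≡ᵇ-true {v} {v} refl =
    cong suc (cong length (filt-all vs (All.map (λ nb → cong not (≡ᵇ-false (λ e → nb (sym e)))) h)))
  length-remove (a ∷ vs) v (h ∷ u) (there m) rewrite ≡ᵇ-false {a} {v} (All-≢-∈ h m) = cong suc (length-remove vs v u m)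

  All-removeAt : ∀ {A : Set} {P : A → Set} {as : List A} → All P as → ∀ i → All P (removeAt as i)
  All-removeAt (p ∷ ps) zero    = ps
  All-removeAt (p ∷ ps) (suc i) = p ∷ All-removeAt ps i

  All-lookup : ∀ {A : Set} {P : A → Set} {as : List A} → All P as → ∀ i → P (lookup as i)
  All-lookup (p ∷ ps) zero    = p
  All-lookup (p ∷ ps) (suc i) = All-lookup ps i

  lookup∷removeAt↭ : ∀ {A : Set} (as : List A) i → (lookup as i ∷ removeAt as i) ↭ as
  lookup∷removeAt↭ (a ∷ as) zero    = Perm.refl
  lookup∷removeAt↭ (a ∷ as) (suc i) =
    Perm.trans (Perm.swap (lookup as i) a Perm.refl) (Perm.prep a (lookup∷removeAt↭ as i))

Cond : ∀ {c ℓ} (F : Field c ℓ) {Λ : Set} (w y z : Λ → Field.Carrier F) → (Λ → Set) → Set ℓ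
Cond F w y z Good = (∀ l → Good l → z l ≈ 0#)
                  ⊎ ((∀ l → Good l → w l ≈ 1#) × (∀ l₁ l₂ → Good l₁ → Good l₂ → y l₁ * z l₂ ≈ y l₂ * z l₁))
  where open Field F

module Canonical {c ℓ} (F : Field c ℓ) (Λ : Set) (w y z : Λ → Field.Carrier F) (x : Field.Carrier F) where

  open Field F
  open VertexNames
  open import Algebra.Solver.Ring.NaturalCoefficients.Default commutativeSemiring using (solve; _:=_; _:+_; _:*_)
  open import Data.Nat as ℕ using (ℕ; zero; suc; _∸_)
  open import Data.Nat.Properties using (∸-+-assoc) renaming (+-comm to ℕ-+-comm)
  open import Data.Bool using (Bool; true; false; if_then_else_; _∨_)
  open import Data.Bool.Properties using (∨-identityʳ; ∨-comm)
  open import Data.List using (List; []; _∷_)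
  open import Data.List.Relation.Unary.All using (All; []; _∷_)
  open import Data.List.Relation.Binary.Permutation.Propositional as Perm using (_↭_)
  open import Data.List.Relation.Binary.Permutation.Propositional.Properties using (All-resp-↭)
  open import Relation.Binary.PropositionalEquality as ≡ using (_≡_; cong; cong₂)
  open import Data.Sum using (inj₁; inj₂)
  open import Data.Product using (proj₁; proj₂)
  open import Relation.Nullary using (¬_)

  power : ℕ → Carrier
  power zero    = 1#
  power (suc n) = x * power n

  -- A state (n , σ , D) describes the graph obtained from a named graph by some
  -- contractions and vertex deletions: the vertex t has been identified with the
  -- vertex σ t, D t says that t has been deleted, and n counts the remaining
  -- vertices.  Contracting or deleting the ends of an edge ab changes the state by:
  merge : (ℕ → ℕ) → ℕ → ℕ → ℕ → ℕ
  merge σ a b t = rename (σ b) (σ a) (σ t)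

  deleteEnds : (ℕ → ℕ) → (ℕ → Bool) → ℕ → ℕ → ℕ → Bool
  deleteEnds σ D a b t = D t ∨ oneOfᵇ (σ t) (σ a) (σ b)

  -- ξ n σ D L evaluates the state, with remaining edge list L, by eliminating the
  -- edges of L in order; edges touching a deleted vertex have disappeared.
  mutual
    ξ : ℕ → (ℕ → ℕ) → (ℕ → Bool) → List (Edge Λ) → Carrier
    ξ n σ D []                = power n
    ξ n σ D ((a , b , l) ∷ L) = if D a ∨ D b then ξ n σ D L else ξ-edge n σ D a b l L

    ξ-edge : ℕ → (ℕ → ℕ) → (ℕ → Bool) → ℕ → ℕ → Λ → List (Edge Λ) → Carrier
    ξ-edge n σ D a b l L =
        (w l * ξ n σ D L + y l * ξ (n ∸ contractLoss (σ a) (σ b)) (merge σ a b) D L)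
      + z l * ξ (n ∸ deleteLoss (σ a) (σ b)) σ (deleteEnds σ D a b) L

  ξ-dead : ∀ n σ D a b l L → (D a ∨ D b) ≡ true → ξ n σ D ((a , b , l) ∷ L) ≡ ξ n σ D L
  ξ-dead n σ D a b l L e rewrite e = ≡.refl

  ξ-live : ∀ n σ D a b l L → (D a ∨ D b) ≡ false → ξ n σ D ((a , b , l) ∷ L) ≡ ξ-edge n σ D a b l L
  ξ-live n σ D a b l L e rewrite e = ≡.refl

  Finer : (ℕ → Bool) → (ℕ → ℕ) → (ℕ → ℕ) → Set
  Finer D σ σ' = ∀ t u → D t ≡ false → D u ≡ false → σ t ≡ σ u → σ' t ≡ σ' u

  Finer-refl : ∀ {D σ} → Finer D σ σ
  Finer-refl t u _ _ e = e

  Finer-shrink : ∀ {D σ σ'} (h : ℕ → Bool) → Finer D σ σ' → Finer (λ t → D t ∨ h t) σ σ'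
  Finer-shrink {D} h k t u dt du = k t u (proj₁ (∨-false {D t} dt)) (proj₁ (∨-false {D u} du))

  oneOf-resp : ∀ {D σ σ' a b t} → Finer D σ σ' → D a ≡ false → D b ≡ false → D t ≡ false →
               OneOf (σ a) (σ b) (σ t) → OneOf (σ' a) (σ' b) (σ' t)
  oneOf-resp {a = a} {b} {t} k da db dt (inj₁ e) = inj₁ (k t a dt da e)
  oneOf-resp {a = a} {b} {t} k da db dt (inj₂ e) = inj₂ (k t b dt db e)

  Finer-merge : ∀ {D σ σ' a b} → Finer D σ σ' → D a ≡ false → D b ≡ false → Finer D (merge σ a b) (merge σ' a b)
  Finer-merge {D} {σ} {σ'} {a} {b} k da db t u dt du e with rename-kernel {σ b} {σ a} {σ t} {σ u} e
  ... | inj₁ p          = cong (rename (σ' b) (σ' a)) (k t u dt du p)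
  ... | inj₂ (ti , ui) = ≡.trans (rename-oneOf (oneOf-resp {σ = σ} k da db dt ti))
                                 (≡.sym (rename-oneOf (oneOf-resp {σ = σ} k da db du ui)))

  module _ {D σ σ' a b} (k : Finer D σ σ') (k' : Finer D σ' σ) (da : D a ≡ false) (db : D b ≡ false) where

    contractLoss-resp : contractLoss (σ a) (σ b) ≡ contractLoss (σ' a) (σ' b)
    contractLoss-resp = contractLoss-cong (k a b da db) (k' a b da db)

    deleteLoss-resp : deleteLoss (σ a) (σ b) ≡ deleteLoss (σ' a) (σ' b)
    deleteLoss-resp = ≡.trans (deleteLoss≡suc (σ a) (σ b))
                        (≡.trans (cong suc contractLoss-resp) (≡.sym (deleteLoss≡suc (σ' a) (σ' b))))

    deleteEnds-resp : ∀ {D'} → (∀ t → D t ≡ D' t) → ∀ t → deleteEnds σ D a b t ≡ deleteEnds σ' D' a b t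
    deleteEnds-resp hD t with D t in e
    ... | true  rewrite ≡.trans (≡.sym (hD t)) e = ≡.refl
    ... | false rewrite ≡.trans (≡.sym (hD t)) e =
      cong₂ _∨_ (≡ᵇ-cong (k t a e da) (k' t a e da)) (≡ᵇ-cong (k t b e db) (k' t b e db))

  ξ-resp : ∀ L {n σ σ' D D'} → (∀ t → D t ≡ D' t) → Finer D σ σ' → Finer D σ' σ → ξ n σ D L ≈ ξ n σ' D' L
  ξ-resp [] hD k k' = refl
  ξ-resp ((a , b , l) ∷ L) {n} {σ} {σ'} {D} {D'} hD k k' with D a ∨ D b in e
  ... | true  = trans (ξ-resp L hD k k') (reflexive (≡.sym (ξ-dead n σ' D' a b l L (≡.trans ends e))))
    where ends = cong₂ _∨_ (≡.sym (hD a)) (≡.sym (hD b))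
  ... | false = trans edge (reflexive (≡.sym (ξ-live n σ' D' a b l L (≡.trans ends e))))
    where
    ends = cong₂ _∨_ (≡.sym (hD a)) (≡.sym (hD b))
    da = proj₁ (∨-false {D a} e)
    db = proj₂ (∨-false {D a} e)
    contracted : ξ (n ∸ contractLoss (σ a) (σ b)) (merge σ a b) D L ≈ ξ (n ∸ contractLoss (σ' a) (σ' b)) (merge σ' a b) D' L
    contracted = trans (ξ-resp L hD (Finer-merge {σ = σ} k da db) (Finer-merge {σ = σ'} k' da db))
                       (reflexive (cong (λ m → ξ (n ∸ m) (merge σ' a b) D' L) (contractLoss-resp k k' da db)))
    deleted : ξ (n ∸ deleteLoss (σ a) (σ b)) σ (deleteEnds σ D a b) L ≈ ξ (n ∸ deleteLoss (σ' a) (σ' b)) σ' (deleteEnds σ' D' a b) L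
    deleted = trans (ξ-resp L (deleteEnds-resp k k' da db hD) (Finer-shrink {σ = σ} _ k) (Finer-shrink {σ = σ'} _ k'))
                    (reflexive (cong (λ m → ξ (n ∸ m) σ' (deleteEnds σ' D' a b) L) (deleteLoss-resp k k' da db)))
    edge : ξ-edge n σ D a b l L ≈ ξ-edge n σ' D' a b l L
    edge = +-cong (+-cong (*-cong refl (ξ-resp L hD k k')) (*-cong refl contracted)) (*-cong refl deleted)

  ∸-twice : ∀ n i j k m → i ℕ.+ j ≡ k ℕ.+ m → n ∸ i ∸ j ≡ n ∸ k ∸ m
  ∸-twice n i j k m e = ≡.trans (∸-+-assoc n i j) (≡.trans (cong (n ∸_) e) (≡.sym (∸-+-assoc n k m)))

  ∨-swapʳ : ∀ p q r → ((p ∨ q) ∨ r) ≡ ((p ∨ r) ∨ q)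
  ∨-swapʳ true  q     r     = ≡.refl
  ∨-swapʳ false true  true  = ≡.refl
  ∨-swapʳ false true  false = ≡.refl
  ∨-swapʳ false false r     = ≡.sym (∨-identityʳ r)

  contract-contract : ∀ n σ D a b c d L →
    ξ (n ∸ contractLoss (σ a) (σ b) ∸ contractLoss (merge σ a b c) (merge σ a b d)) (merge (merge σ a b) c d) D L
    ≈ ξ (n ∸ contractLoss (σ c) (σ d) ∸ contractLoss (merge σ c d a) (merge σ c d b)) (merge (merge σ c d) a b) D L
  contract-contract n σ D a b c d L =
    trans (ξ-resp L (λ _ → ≡.refl) (λ t u _ _ → merge₂-swap (σ a) (σ b) (σ c) (σ d) (σ t) (σ u))
                                   (λ t u _ _ → merge₂-swap (σ c) (σ d) (σ a) (σ b) (σ t) (σ u)))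
          (reflexive (cong (λ m → ξ m (merge (merge σ c d) a b) D L) counts))
    where
    counts : n ∸ contractLoss (σ a) (σ b) ∸ contractLoss (merge σ a b c) (merge σ a b d)
           ≡ n ∸ contractLoss (σ c) (σ d) ∸ contractLoss (merge σ c d a) (merge σ c d b)
    counts = ∸-twice n (contractLoss (σ a) (σ b)) (contractLoss (merge σ a b c) (merge σ a b d))
                       (contractLoss (σ c) (σ d)) (contractLoss (merge σ c d a) (merge σ c d b))
                       (contractLoss-swap (σ a) (σ b) (σ c) (σ d))

  delete-delete : ∀ n σ D a b c d L →
    ξ (n ∸ deleteLoss (σ a) (σ b) ∸ deleteLoss (σ c) (σ d)) σ (deleteEnds σ (deleteEnds σ D a b) c d) L
    ≈ ξ (n ∸ deleteLoss (σ c) (σ d) ∸ deleteLoss (σ a) (σ b)) σ (deleteEnds σ (deleteEnds σ D c d) a b) L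
  delete-delete n σ D a b c d L =
    trans (ξ-resp L (λ t → ∨-swapʳ (D t) (oneOfᵇ (σ t) (σ a) (σ b)) (oneOfᵇ (σ t) (σ c) (σ d))) Finer-refl Finer-refl)
          (reflexive (cong (λ m → ξ m σ (deleteEnds σ (deleteEnds σ D c d) a b) L) counts))
    where
    counts : n ∸ deleteLoss (σ a) (σ b) ∸ deleteLoss (σ c) (σ d) ≡ n ∸ deleteLoss (σ c) (σ d) ∸ deleteLoss (σ a) (σ b)
    counts = ∸-twice n (deleteLoss (σ a) (σ b)) (deleteLoss (σ c) (σ d)) (deleteLoss (σ c) (σ d)) (deleteLoss (σ a) (σ b))
                       (ℕ-+-comm (deleteLoss (σ a) (σ b)) (deleteLoss (σ c) (σ d)))

  contract-delete-apart : ∀ n σ D a b c d L → ¬ OneOf (σ a) (σ b) (σ c) → ¬ OneOf (σ a) (σ b) (σ d) →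
    ξ (n ∸ contractLoss (σ a) (σ b) ∸ deleteLoss (merge σ a b c) (merge σ a b d)) (merge σ a b) (deleteEnds (merge σ a b) D c d) L
    ≈ ξ (n ∸ deleteLoss (σ c) (σ d) ∸ contractLoss (σ a) (σ b)) (merge σ a b) (deleteEnds σ D c d) L
  contract-delete-apart n σ D a b c d L nc nd =
    trans (ξ-resp L (λ t → cong (D t ∨_) (cong₂ _∨_ (rename-≡ᵇ-outside (σ t) nc) (rename-≡ᵇ-outside (σ t) nd)))
                    Finer-refl Finer-refl)
          (reflexive (cong (λ m → ξ m (merge σ a b) (deleteEnds σ D c d) L) counts))
    where
    counts : n ∸ contractLoss (σ a) (σ b) ∸ deleteLoss (merge σ a b c) (merge σ a b d)
           ≡ n ∸ deleteLoss (σ c) (σ d) ∸ contractLoss (σ a) (σ b)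
    counts = ≡.trans (cong₂ (λ p q → n ∸ contractLoss (σ a) (σ b) ∸ deleteLoss p q)
                            (rename-other (λ p → nc (inj₂ p))) (rename-other (λ p → nd (inj₂ p))))
                     (∸-twice n (contractLoss (σ a) (σ b)) (deleteLoss (σ c) (σ d)) (deleteLoss (σ c) (σ d)) (contractLoss (σ a) (σ b))
                               (ℕ-+-comm (contractLoss (σ a) (σ b)) (deleteLoss (σ c) (σ d))))

  -- if cd meets ab: contracting ab then deleting the ends of cd deletes all of
  -- a, b, c, d, and so does contracting cd then deleting the ends of ab
  contract-delete-meeting : ∀ n σ D a b c d L → Meets (σ a) (σ b) (σ c) (σ d) →
    ξ (n ∸ contractLoss (σ a) (σ b) ∸ deleteLoss (merge σ a b c) (merge σ a b d)) (merge σ a b) (deleteEnds (merge σ a b) D c d) L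
    ≈ ξ (n ∸ contractLoss (σ c) (σ d) ∸ deleteLoss (merge σ c d a) (merge σ c d b)) (merge σ c d) (deleteEnds (merge σ c d) D a b) L
  contract-delete-meeting n σ D a b c d L meet =
    trans (ξ-resp L sameDeleted untouched untouched⁻¹)
          (reflexive (cong (λ m → ξ m (merge σ c d) (deleteEnds (merge σ c d) D a b) L) counts))
    where
    A = σ a
    B = σ b
    C = σ c
    E = σ d
    sameDeleted : ∀ t → deleteEnds (merge σ a b) D c d t ≡ deleteEnds (merge σ c d) D a b t
    sameDeleted t = cong (D t ∨_) (≡.trans (rename-hits-meeting (σ t) meet)
                                   (≡.trans (∨-comm (oneOfᵇ (σ t) A B) (oneOfᵇ (σ t) C E))
                                            (≡.sym (rename-hits-meeting (σ t) (Meets-sym meet)))))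
    -- a vertex that survives is neither in {A , B} nor in {C , E}, so both merges fix it
    fixed : ∀ t → deleteEnds (merge σ a b) D c d t ≡ false → rename B A (σ t) ≡ σ t × rename E C (σ t) ≡ σ t
    fixed t e with ∨-false {oneOfᵇ (σ t) A B}
                    (≡.trans (≡.sym (rename-hits-meeting (σ t) meet)) (proj₂ (∨-false {D t} e)))
    ... | (p , q) = rename-other (λ r → oneOfᵇ-false {σ t} {A} {B} p (inj₂ r))
                  , rename-other (λ r → oneOfᵇ-false {σ t} {C} {E} q (inj₂ r))
    untouched : Finer (deleteEnds (merge σ a b) D c d) (merge σ a b) (merge σ c d)
    untouched t u dt du e =
      ≡.trans (proj₂ (fixed t dt)) (≡.trans (≡.sym (proj₁ (fixed t dt)))
              (≡.trans e (≡.trans (proj₁ (fixed u du)) (≡.sym (proj₂ (fixed u du))))))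
    untouched⁻¹ : Finer (deleteEnds (merge σ a b) D c d) (merge σ c d) (merge σ a b)
    untouched⁻¹ t u dt du e =
      ≡.trans (proj₁ (fixed t dt)) (≡.trans (≡.sym (proj₂ (fixed t dt)))
              (≡.trans e (≡.trans (proj₂ (fixed u du)) (≡.sym (proj₁ (fixed u du))))))
    counts : n ∸ contractLoss A B ∸ deleteLoss (rename B A C) (rename B A E)
           ≡ n ∸ contractLoss C E ∸ deleteLoss (rename E C A) (rename E C B)
    counts = ∸-twice n (contractLoss A B) (deleteLoss (rename B A C) (rename B A E))
                       (contractLoss C E) (deleteLoss (rename E C A) (rename E C B))
                       (contract-delete-loss-swap A B C E)

  -- Eliminating e (label weights wl, yl, zl)
  -- and then f (weights wk, yk, zk) produces the nine values S (neither edge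
  -- acted on), Ce, Te, Cf, Tf (one edge contracted / its ends deleted) and
  -- CeCf, CeTf, TeCf, TeTf (both, e first); eliminating f first produces the
  -- same values with the order of the pairs reversed.

  interchange-apart : ∀ wl yl zl wk yk zk S Ce Te Cf Tf CeCf CeTf TeCf TeTf CfCe TfCe CfTe TfTe →
    CeCf ≈ CfCe → CeTf ≈ TfCe → TeCf ≈ CfTe → TeTf ≈ TfTe →
      (wl * ((wk * S + yk * Cf) + zk * Tf) + yl * ((wk * Ce + yk * CeCf) + zk * CeTf)) + zl * ((wk * Te + yk * TeCf) + zk * TeTf)
    ≈ (wk * ((wl * S + yl * Ce) + zl * Te) + yk * ((wl * Cf + yl * CfCe) + zl * CfTe)) + zk * ((wl * Tf + yl * TfCe) + zl * TfTe)
  interchange-apart wl yl zl wk yk zk S Ce Te Cf Tf CeCf CeTf TeCf TeTf CfCe TfCe CfTe TfTe hCC hCT hTC hTT =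
    trans (rearrange wl yl zl wk yk zk S Ce Te Cf Tf CeCf CeTf TeCf TeTf)
          (+-cong (+-cong refl (*-cong refl (+-cong (+-cong refl (*-cong refl hCC)) (*-cong refl hTC))))
                  (*-cong refl (+-cong (+-cong refl (*-cong refl hCT)) (*-cong refl hTT))))
    where
    rearrange = solve 15 (λ wl yl zl wk yk zk S Ce Te Cf Tf CeCf CeTf TeCf TeTf →
        (wl :* ((wk :* S :+ yk :* Cf) :+ zk :* Tf) :+ yl :* ((wk :* Ce :+ yk :* CeCf) :+ zk :* CeTf))
          :+ zl :* ((wk :* Te :+ yk :* TeCf) :+ zk :* TeTf)
      := (wk :* ((wl :* S :+ yl :* Ce) :+ zl :* Te) :+ yk :* ((wl :* Cf :+ yl :* CeCf) :+ zl :* TeCf))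
          :+ zk :* ((wl :* Tf :+ yl :* CeTf) :+ zl :* TeTf)) refl

  -- If f meets e, then f disappears when the ends of e are deleted and vice
  -- versa; the two orders then agree under either hypothesis of the theorem.
  interchange-meeting-z : ∀ wl yl zl wk yk zk S Ce Te Cf Tf CeCf CeTf CfCe CfTe →
    zl ≈ 0# → zk ≈ 0# → CeCf ≈ CfCe →
      (wl * ((wk * S + yk * Cf) + zk * Tf) + yl * ((wk * Ce + yk * CeCf) + zk * CeTf)) + zl * Te
    ≈ (wk * ((wl * S + yl * Ce) + zl * Te) + yk * ((wl * Cf + yl * CfCe) + zl * CfTe)) + zk * Tf
  interchange-meeting-z wl yl zl wk yk zk S Ce Te Cf Tf CeCf CeTf CfCe CfTe hl hk hCC =
    trans (expandˡ wl yl zl wk yk zk S Ce Te Cf Tf CeCf CeTf)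
      (trans (+-cong (+-cong refl (+-cong refl (*-cong refl hCC))) (trans (vanish hl hk) (sym (vanish hl hk))))
             (sym (expandʳ wl yl zl wk yk zk S Ce Te Cf Tf CfCe CfTe)))
    where
    vanish : ∀ {u v X Y} → u ≈ 0# → v ≈ 0# → u * X + v * Y ≈ 0#
    vanish {X = X} {Y} hu hv =
      trans (+-cong (trans (*-cong hu refl) (zeroˡ X)) (trans (*-cong hv refl) (zeroˡ Y))) (+-identityʳ 0#)
    expandˡ = solve 13 (λ wl yl zl wk yk zk S Ce Te Cf Tf CeCf CeTf →
        (wl :* ((wk :* S :+ yk :* Cf) :+ zk :* Tf) :+ yl :* ((wk :* Ce :+ yk :* CeCf) :+ zk :* CeTf)) :+ zl :* Te
      := (((wl :* wk) :* S :+ (wl :* yk) :* Cf) :+ ((yl :* wk) :* Ce :+ (yl :* yk) :* CeCf))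
          :+ (zl :* Te :+ zk :* (wl :* Tf :+ yl :* CeTf))) refl
    expandʳ = solve 13 (λ wl yl zl wk yk zk S Ce Te Cf Tf CfCe CfTe →
        (wk :* ((wl :* S :+ yl :* Ce) :+ zl :* Te) :+ yk :* ((wl :* Cf :+ yl :* CfCe) :+ zl :* CfTe)) :+ zk :* Tf
      := (((wl :* wk) :* S :+ (wl :* yk) :* Cf) :+ ((yl :* wk) :* Ce :+ (yl :* yk) :* CfCe))
          :+ (zl :* (wk :* Te :+ yk :* CfTe) :+ zk :* Tf)) refl

  interchange-meeting-w : ∀ wl yl zl wk yk zk S Ce Te Cf Tf CeCf CeTf CfCe CfTe →
    wl ≈ 1# → wk ≈ 1# → yl * zk ≈ yk * zl → CeCf ≈ CfCe → CeTf ≈ CfTe →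
      (wl * ((wk * S + yk * Cf) + zk * Tf) + yl * ((wk * Ce + yk * CeCf) + zk * CeTf)) + zl * Te
    ≈ (wk * ((wl * S + yl * Ce) + zl * Te) + yk * ((wl * Cf + yl * CfCe) + zl * CfTe)) + zk * Tf
  interchange-meeting-w wl yl zl wk yk zk S Ce Te Cf Tf CeCf CeTf CfCe CfTe hwl hwk hyz hCC hCT =
    trans (+-cong (+-cong (trans (unit hwl) (+-cong (+-cong (unit hwk) refl) refl))
                          (*-cong refl (+-cong (+-cong (unit hwk) refl) refl))) refl)
     (trans (expandˡ yl zl yk zk S Ce Te Cf Tf CeCf CeTf)
      (trans (+-cong (+-cong refl (+-cong (+-cong refl (*-cong refl hCC)) refl)) (*-cong hyz hCT))
       (sym (trans (+-cong (+-cong (trans (unit hwk) (+-cong (+-cong (unit hwl) refl) refl))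
                                   (*-cong refl (+-cong (+-cong (unit hwl) refl) refl))) refl)
                   (expandʳ yl zl yk zk S Ce Te Cf Tf CfCe CfTe)))))
    where
    unit : ∀ {u X} → u ≈ 1# → u * X ≈ X
    unit {X = X} h = trans (*-cong h refl) (*-identityˡ X)
    expandˡ = solve 11 (λ yl zl yk zk S Ce Te Cf Tf CeCf CeTf →
        (((S :+ yk :* Cf) :+ zk :* Tf) :+ yl :* ((Ce :+ yk :* CeCf) :+ zk :* CeTf)) :+ zl :* Te
      := ((S :+ yk :* Cf) :+ zk :* Tf) :+ ((yl :* Ce :+ (yl :* yk) :* CeCf) :+ zl :* Te) :+ (yl :* zk) :* CeTf) refl
    expandʳ = solve 11 (λ yl zl yk zk S Ce Te Cf Tf CfCe CfTe →
        (((S :+ yl :* Ce) :+ zl :* Te) :+ yk :* ((Cf :+ yl :* CfCe) :+ zl :* CfTe)) :+ zk :* Tf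
      := ((S :+ yk :* Cf) :+ zk :* Tf) :+ ((yl :* Ce :+ (yl :* yk) :* CfCe) :+ zl :* Te) :+ (yk :* zl) :* CfTe) refl

  module Successors (n : ℕ) (σ : ℕ → ℕ) (D : ℕ → Bool) (L : List (Edge Λ)) (a b c d : ℕ) where
    nC = n ∸ contractLoss (σ a) (σ b)
    σC = merge σ a b
    nT = n ∸ deleteLoss (σ a) (σ b)
    DT = deleteEnds σ D a b
    S  = ξ n σ D L
    C₁ = ξ nC σC D L
    T₁ = ξ nT σ DT L
    C₂ = ξ (n ∸ contractLoss (σ c) (σ d)) (merge σ c d) D L
    T₂ = ξ (n ∸ deleteLoss (σ c) (σ d)) σ (deleteEnds σ D c d) L
    C₁C₂ = ξ (nC ∸ contractLoss (σC c) (σC d)) (merge σC c d) D L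
    C₁T₂ = ξ (nC ∸ deleteLoss (σC c) (σC d)) σC (deleteEnds σC D c d) L
    T₁C₂ = ξ (nT ∸ contractLoss (σ c) (σ d)) (merge σ c d) DT L
    T₁T₂ = ξ (nT ∸ deleteLoss (σ c) (σ d)) σ (deleteEnds σ DT c d) L

  -- unfolding ξ on two live edges; the second edge survives contraction of the first
  ξ-two-live : ∀ n σ D a b l c d k L → (D a ∨ D b) ≡ false → (D c ∨ D d) ≡ false →
    let open Successors n σ D L a b c d in
    ξ n σ D ((a , b , l) ∷ (c , d , k) ∷ L)
      ≡ (w l * ((w k * S + y k * C₂) + z k * T₂) + y l * ((w k * C₁ + y k * C₁C₂) + z k * C₁T₂)) + z l * ξ nT σ DT ((c , d , k) ∷ L)
  ξ-two-live n σ D a b l c d k L ea fa rewrite ea | fa = ≡.refl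

  deleteEnds-meets : ∀ σ D a b c d → D c ≡ false → D d ≡ false →
                     (deleteEnds σ D a b c ∨ deleteEnds σ D a b d) ≡ meetsᵇ (σ a) (σ b) (σ c) (σ d)
  deleteEnds-meets σ D a b c d dc dd rewrite dc | dd = ≡.refl

  deleteEnds-dead : ∀ σ D c d a b → (D a ∨ D b) ≡ true → (deleteEnds σ D c d a ∨ deleteEnds σ D c d b) ≡ true
  deleteEnds-dead σ D c d a b e with ∨-true {D a} e
  ... | inj₁ p = ∨-trueˡ (deleteEnds σ D c d b) (∨-trueˡ (oneOfᵇ (σ a) (σ c) (σ d)) p)
  ... | inj₂ p = ∨-trueʳ (deleteEnds σ D c d a) (∨-trueˡ (oneOfᵇ (σ b) (σ c) (σ d)) p)

  -- a dead edge stays dead in every successor state, so it commutes with any edge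
  swap-dead : ∀ n σ D a b l f L → (D a ∨ D b) ≡ true → ξ n σ D ((a , b , l) ∷ f ∷ L) ≈ ξ n σ D (f ∷ (a , b , l) ∷ L)
  swap-dead n σ D a b l (c , d , k) L ea with true-or-false (D c ∨ D d)
  ... | inj₁ fa = reflexive (≡.trans (ξ-dead n σ D a b l ((c , d , k) ∷ L) ea)
                            (≡.trans (ξ-dead n σ D c d k L fa)
                            (≡.sym (≡.trans (ξ-dead n σ D c d k ((a , b , l) ∷ L) fa) (ξ-dead n σ D a b l L ea)))))
  ... | inj₂ fa = reflexive (≡.trans (ξ-dead n σ D a b l ((c , d , k) ∷ L) ea)
                            (≡.trans (ξ-live n σ D c d k L fa)
                            (≡.sym (≡.trans (ξ-live n σ D c d k ((a , b , l) ∷ L) fa) eDead))))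
    where
    eDead : ξ-edge n σ D c d k ((a , b , l) ∷ L) ≡ ξ-edge n σ D c d k L
    eDead = cong₂ _+_ (cong₂ _+_ (cong (w k *_) (ξ-dead n σ D a b l L ea))
                                 (cong (y k *_) (ξ-dead _ (merge σ c d) D a b l L ea)))
                      (cong (z k *_) (ξ-dead _ σ (deleteEnds σ D c d) a b l L (deleteEnds-dead σ D c d a b ea)))


  ξ-two-apart : ∀ n σ D a b l c d k L → (D a ∨ D b) ≡ false → (D c ∨ D d) ≡ false →
    meetsᵇ (σ a) (σ b) (σ c) (σ d) ≡ false →
    let open Successors n σ D L a b c d in
    ξ n σ D ((a , b , l) ∷ (c , d , k) ∷ L)
      ≡ (w l * ((w k * S + y k * C₂) + z k * T₂) + y l * ((w k * C₁ + y k * C₁C₂) + z k * C₁T₂))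
        + z l * ((w k * T₁ + y k * T₁C₂) + z k * T₁T₂)
  ξ-two-apart n σ D a b l c d k L ea fa apart =
    ≡.trans (ξ-two-live n σ D a b l c d k L ea fa)
            (cong₂ _+_ ≡.refl (cong (z l *_) (ξ-live _ σ (deleteEnds σ D a b) c d k L
                                          (≡.trans (deleteEnds-meets σ D a b c d dc dd) apart))))
    where
    dc = proj₁ (∨-false {D c} fa)
    dd = proj₂ (∨-false {D c} fa)

  ξ-two-meeting : ∀ n σ D a b l c d k L → (D a ∨ D b) ≡ false → (D c ∨ D d) ≡ false →
    meetsᵇ (σ a) (σ b) (σ c) (σ d) ≡ true →
    let open Successors n σ D L a b c d in
    ξ n σ D ((a , b , l) ∷ (c , d , k) ∷ L)
      ≡ (w l * ((w k * S + y k * C₂) + z k * T₂) + y l * ((w k * C₁ + y k * C₁C₂) + z k * C₁T₂)) + z l * T₁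
  ξ-two-meeting n σ D a b l c d k L ea fa meet =
    ≡.trans (ξ-two-live n σ D a b l c d k L ea fa)
            (cong₂ _+_ ≡.refl (cong (z l *_) (ξ-dead _ σ (deleteEnds σ D a b) c d k L
                                          (≡.trans (deleteEnds-meets σ D a b c d dc dd) meet))))
    where
    dc = proj₁ (∨-false {D c} fa)
    dd = proj₂ (∨-false {D c} fa)

  module Reorder (Good : Λ → Set) (cond : Cond F w y z Good) where

    swap-live : ∀ n σ D a b l c d k L → Good l → Good k → (D a ∨ D b) ≡ false → (D c ∨ D d) ≡ false →
                ξ n σ D ((a , b , l) ∷ (c , d , k) ∷ L) ≈ ξ n σ D ((c , d , k) ∷ (a , b , l) ∷ L)
    swap-live n σ D a b l c d k L gl gk ea fa with true-or-false (meetsᵇ (σ a) (σ b) (σ c) (σ d))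
    ... | inj₂ apart =
      trans (reflexive (ξ-two-apart n σ D a b l c d k L ea fa apart))
     (trans (interchange-apart (w l) (y l) (z l) (w k) (y k) (z k) S C₁ T₁ C₂ T₂ C₁C₂ C₁T₂ T₁C₂ T₁T₂
                               FE.C₁C₂ FE.T₁C₂ FE.C₁T₂ FE.T₁T₂
               (contract-contract n σ D a b c d L)
               (contract-delete-apart n σ D a b c d L (proj₁ cdOutside) (proj₂ cdOutside))
               (sym (contract-delete-apart n σ D c d a b L (proj₁ abOutside) (proj₂ abOutside)))
               (delete-delete n σ D a b c d L))
            (reflexive (≡.sym (ξ-two-apart n σ D c d k a b l L fa ea apart'))))
      where
      open Successors n σ D L a b c d
      module FE = Successors n σ D L c d a b
      apart' = ≡.trans (≡.sym (meetsᵇ-sym (σ a) (σ b) (σ c) (σ d))) apart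
      cdOutside = meetsᵇ-false {σ a} {σ b} {σ c} {σ d} apart
      abOutside = meetsᵇ-false {σ c} {σ d} {σ a} {σ b} apart'
    ... | inj₁ meet =
      trans (reflexive (ξ-two-meeting n σ D a b l c d k L ea fa meet))
     (trans (byCondition cond)
            (reflexive (≡.sym (ξ-two-meeting n σ D c d k a b l L fa ea meet'))))
      where
      open Successors n σ D L a b c d
      module FE = Successors n σ D L c d a b
      meet' = ≡.trans (≡.sym (meetsᵇ-sym (σ a) (σ b) (σ c) (σ d))) meet
      byCondition : Cond F w y z Good →
          (w l * ((w k * S + y k * C₂) + z k * T₂) + y l * ((w k * C₁ + y k * C₁C₂) + z k * C₁T₂)) + z l * T₁
        ≈ (w k * ((w l * S + y l * C₁) + z l * T₁) + y k * ((w l * C₂ + y l * FE.C₁C₂) + z l * FE.C₁T₂)) + z k * T₂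
      byCondition (inj₁ z≈0) =
        interchange-meeting-z (w l) (y l) (z l) (w k) (y k) (z k) S C₁ T₁ C₂ T₂ C₁C₂ C₁T₂ FE.C₁C₂ FE.C₁T₂
          (z≈0 l gl) (z≈0 k gk) (contract-contract n σ D a b c d L)
      byCondition (inj₂ (w≈1 , yz≈zy)) =
        interchange-meeting-w (w l) (y l) (z l) (w k) (y k) (z k) S C₁ T₁ C₂ T₂ C₁C₂ C₁T₂ FE.C₁C₂ FE.C₁T₂
          (w≈1 l gl) (w≈1 k gk) (yz≈zy l k gl gk) (contract-contract n σ D a b c d L)
          (contract-delete-meeting n σ D a b c d L (meetsᵇ-sound meet))

    GoodEdge : Edge Λ → Set
    GoodEdge (_ , _ , l) = Good l

    swap : ∀ n σ D e f L → GoodEdge e → GoodEdge f → ξ n σ D (e ∷ f ∷ L) ≈ ξ n σ D (f ∷ e ∷ L)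
    swap n σ D (a , b , l) (c , d , k) L ge gf with true-or-false (D a ∨ D b) | true-or-false (D c ∨ D d)
    ... | inj₁ ea | _       = swap-dead n σ D a b l (c , d , k) L ea
    ... | inj₂ ea | inj₁ fa = sym (swap-dead n σ D c d k (a , b , l) L fa)
    ... | inj₂ ea | inj₂ fa = swap-live n σ D a b l c d k L ge gf ea fa

    prepend : ∀ e {L L'} → (∀ n σ D → ξ n σ D L ≈ ξ n σ D L') → ∀ n σ D → ξ n σ D (e ∷ L) ≈ ξ n σ D (e ∷ L')
    prepend (a , b , l) {L} {L'} h n σ D with true-or-false (D a ∨ D b)
    ... | inj₁ ea = trans (reflexive (ξ-dead n σ D a b l L ea))
                          (trans (h n σ D) (reflexive (≡.sym (ξ-dead n σ D a b l L' ea))))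
    ... | inj₂ ea = trans (reflexive (ξ-live n σ D a b l L ea))
                          (trans (+-cong (+-cong (*-cong refl (h _ _ _)) (*-cong refl (h _ _ _))) (*-cong refl (h _ _ _)))
                                 (reflexive (≡.sym (ξ-live n σ D a b l L' ea))))

    ξ-↭ : ∀ {L L'} → L ↭ L' → All GoodEdge L → ∀ n σ D → ξ n σ D L ≈ ξ n σ D L'
    ξ-↭ Perm.refl gs n σ D = refl
    ξ-↭ {e ∷ L} {_ ∷ L'} (Perm.prep e p) (_ ∷ gs) = prepend e {L} {L'} (ξ-↭ p gs)
    ξ-↭ {e ∷ f ∷ L} {_ ∷ _ ∷ L'} (Perm.swap e f p) (ge ∷ gf ∷ gs) n σ D =
      trans (swap n σ D e f L ge gf) (prepend f {e ∷ L} {e ∷ L'} (prepend e {L} {L'} (ξ-↭ p gs)) n σ D)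
    ξ-↭ (Perm.trans p q) gs n σ D = trans (ξ-↭ p gs n σ D) (ξ-↭ q (All-resp-↭ p gs) n σ D)

module Graphs {c ℓ} (F : Field c ℓ) (Λ : Set) (w y z : Λ → Field.Carrier F) (x : Field.Carrier F) where

  open Field F hiding (zero)
  open VertexNames
  open Canonical F Λ w y z x
  open ListFacts Λ
  open import Algebra.Solver.Ring.NaturalCoefficients.Default commutativeSemiring using (solve; _:=_; _:+_; _:*_)
  open import Data.Nat as ℕ using (ℕ; zero; suc; _∸_; _≡ᵇ_; _<_; s≤s)
  open import Data.Nat.Properties using (≤-trans; ≤-refl)
  open import Data.Bool using (Bool; true; false; if_then_else_; not; _∨_; _∧_)
  open import Data.Bool.Properties using (∨-assoc; ∨-identityʳ; ∨-idem; ∧-zeroʳ; not-involutive)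
  open import Data.List using (List; []; _∷_; length; removeAt; lookup)
  open import Data.List.Relation.Unary.All as All using (All; []; _∷_)
  open import Data.List.Membership.Propositional using (_∈_)
  open import Data.List.Relation.Unary.Unique.Propositional using (Unique)
  open import Data.Fin using (zero)
  open import Relation.Binary.PropositionalEquality as ≡ using (_≡_; cong; cong₂)
  open import Relation.Nullary using (¬_)
  open import Relation.Nullary.Reflects using (ofʸ; ofⁿ)
  open import Data.Sum using (inj₁; inj₂)
  open import Data.Product using (_×_; _,_; proj₁; proj₂)

  nothingDeleted : ℕ → Bool
  nothingDeleted _ = false

  canonical : MGraph Λ → Carrier
  canonical H = ξ (length (verts H)) (λ t → t) nothingDeleted (edges H)

  ξ-rename : ∀ L n σ D v u → ξ n σ D (mapList (renE Λ v u) L) ≡ ξ n (λ t → σ (rename v u t)) (λ t → D (rename v u t)) L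
  ξ-rename [] n σ D v u = ≡.refl
  ξ-rename ((a , b , l) ∷ L) n σ D v u with true-or-false (D (rename v u a) ∨ D (rename v u b))
  ... | inj₁ e = ≡.trans (ξ-dead n σ D (rename v u a) (rename v u b) l (mapList (renE Λ v u) L) e)
                   (≡.trans (ξ-rename L n σ D v u) (≡.sym (ξ-dead n _ _ a b l L e)))
  ... | inj₂ e = ≡.trans (ξ-live n σ D (rename v u a) (rename v u b) l (mapList (renE Λ v u) L) e)
                   (≡.trans (cong₂ _+_ (cong₂ _+_ (cong (w l *_) (ξ-rename L _ _ _ v u))
                                                  (cong (y l *_) (ξ-rename L _ _ _ v u)))
                                       (cong (z l *_) (ξ-rename L _ _ _ v u)))
                            (≡.sym (ξ-live n _ _ a b l L e)))

  ∨-true-inner : ∀ {a b} c d → (a ∨ b) ≡ true → ((c ∨ a) ∨ (d ∨ b)) ≡ true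
  ∨-true-inner {a} {b} c d e with ∨-true {a} e
  ... | inj₁ p = ∨-trueˡ (d ∨ b) (∨-trueʳ c p)
  ... | inj₂ p = ∨-trueʳ (c ∨ a) (∨-trueʳ d p)

  ∨-false-inner : ∀ {a b} c d → (a ∨ b) ≡ false → ((c ∨ a) ∨ (d ∨ b)) ≡ (c ∨ d)
  ∨-false-inner {false} {false} c d ≡.refl rewrite ∨-identityʳ c | ∨-identityʳ d = ≡.refl

  ξ-filter : ∀ L n σ D (Q : ℕ → Bool) (p : Edge Λ → Bool) → (∀ a b l → p (a , b , l) ≡ not (Q a ∨ Q b)) →
             ξ n σ D (filt p L) ≈ ξ n σ (λ t → D t ∨ Q t) L
  ξ-filter [] n σ D Q p hp = refl
  ξ-filter ((a , b , l) ∷ L) n σ D Q p hp with true-or-false (Q a ∨ Q b)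
  ... | inj₁ q = trans (reflexive (cong (ξ n σ D) (filt-drop L (≡.trans (hp a b l) (cong not q)))))
                   (trans (ξ-filter L n σ D Q p hp)
                          (reflexive (≡.sym (ξ-dead n σ _ a b l L (∨-true-inner (D a) (D b) q)))))
  ... | inj₂ q with true-or-false (D a ∨ D b)
  ...   | inj₁ e = trans (reflexive (≡.trans (cong (ξ n σ D) (filt-keep L (≡.trans (hp a b l) (cong not q))))
                                             (ξ-dead n σ D a b l (filt p L) e)))
                   (trans (ξ-filter L n σ D Q p hp)
                          (reflexive (≡.sym (ξ-dead n σ _ a b l L (≡.trans (∨-false-inner (D a) (D b) q) e)))))
  ...   | inj₂ e = trans (reflexive (≡.trans (cong (ξ n σ D) (filt-keep L (≡.trans (hp a b l) (cong not q))))
                                             (ξ-live n σ D a b l (filt p L) e)))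
                   (trans (+-cong (+-cong (*-cong refl (ξ-filter L _ _ _ Q p hp)) (*-cong refl (ξ-filter L _ _ _ Q p hp)))
                                  (*-cong refl (trans (ξ-filter L _ _ _ Q p hp)
                                     (ξ-resp L (λ t → ∨-swapʳ (D t) (oneOfᵇ (σ t) (σ a) (σ b)) (Q t)) Finer-refl Finer-refl))))
                          (reflexive (≡.sym (ξ-live n σ _ a b l L (≡.trans (∨-false-inner (D a) (D b) q) e)))))

  not-∨ : ∀ a b → not (a ∨ b) ≡ (not a ∧ not b)
  not-∨ true  b = ≡.refl
  not-∨ false b = ≡.refl

  length-remove-ends : ∀ vs u v → Unique vs → u ∈ vs → v ∈ vs →
                       length (filt (λ a → not ((a ≡ᵇ u) ∨ (a ≡ᵇ v))) vs) ≡ length vs ∸ deleteLoss u v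
  length-remove-ends vs u v uq um vm with u ≡ᵇ v | ≡ᵇ-reflects u v
  ... | true | ofʸ ≡.refl =
    ≡.trans (cong length (filt-ext (λ a → cong not (∨-idem (a ≡ᵇ u))) vs)) (cong (_∸ 1) (length-remove vs u uq um))
  ... | false | ofⁿ u≢v =
    ≡.trans (cong length (≡.trans (filt-ext (λ a → not-∨ (a ≡ᵇ u) (a ≡ᵇ v)) vs)
                                  (≡.sym (filt-filt (λ a → not (a ≡ᵇ v)) (λ a → not (a ≡ᵇ u)) vs))))
      (cong (_∸ 2) (≡.trans (cong suc (length-remove (filt (λ a → not (a ≡ᵇ u)) vs) v (Unique-filt uq)
                                                       (∈-filt vm (cong not (≡ᵇ-false (λ e → u≢v (≡.sym e)))))))
                            (length-remove vs u uq um)))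

  canonical-first-edge : ∀ vs u v l L → WF Λ (mkG vs ((u , v , l) ∷ L)) →
    let H = mkG vs ((u , v , l) ∷ L) in
    canonical H ≈ (w l * canonical (del Λ H zero) + y l * canonical (con Λ H zero)) + z l * canonical (dag Λ H zero)
  canonical-first-edge vs u v l L (uq , ((um , vm) ∷ _)) =
    +-cong (+-cong refl (*-cong refl (contracted (u ≡ᵇ v) ≡.refl))) (*-cong refl deleted)
    where
    n = length vs
    contracted : ∀ isLoop → (u ≡ᵇ v) ≡ isLoop →
      ξ (n ∸ contractLoss u v) (rename v u) nothingDeleted L
      ≈ canonical (if isLoop then mkG vs L else mkG (filt (λ a → not (a ≡ᵇ v)) vs) (mapList (renE Λ v u) L))
    contracted true e =
      trans (reflexive (cong (λ m → ξ (n ∸ m) (rename v u) nothingDeleted L) (cong (λ b → if b then 0 else 1) e)))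
            (ξ-resp L (λ _ → ≡.refl) (λ t s _ _ q → ≡.trans (≡.sym (unchanged t)) (≡.trans q (unchanged s)))
                                     (λ t s _ _ q → cong (rename v u) q))
      where
      unchanged : ∀ t → rename v u t ≡ t
      unchanged t = ≡.subst (λ s → rename s u t ≡ t) (≡ᵇ-sound e) (rename-self u t)
    contracted false e =
      reflexive (≡.sym (≡.trans (ξ-rename L _ (λ t → t) nothingDeleted v u)
                        (cong (λ m → ξ m (rename v u) nothingDeleted L)
                              (≡.trans (cong (_∸ 1) (length-remove vs v uq vm))
                                       (cong (λ b → n ∸ (if b then 0 else 1)) (≡.sym e))))))
    deleted : ξ (n ∸ deleteLoss u v) (λ t → t) (deleteEnds (λ t → t) nothingDeleted u v) L
              ≈ canonical (dag Λ (mkG vs ((u , v , l) ∷ L)) zero)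
    deleted = sym (trans (ξ-filter L _ (λ t → t) nothingDeleted (λ t → (t ≡ᵇ u) ∨ (t ≡ᵇ v)) _
                            (λ a b l → cong not (≡.sym (∨-assoc (a ≡ᵇ u) (a ≡ᵇ v) ((b ≡ᵇ u) ∨ (b ≡ᵇ v))))))
                         (reflexive (cong (λ m → ξ m (λ t → t) (deleteEnds (λ t → t) nothingDeleted u v) L)
                                          (length-remove-ends vs u v uq um vm))))

  Endpoints∈ : List ℕ → Edge Λ → Set
  Endpoints∈ vs (a , b , _) = (a ∈ vs) × (b ∈ vs)

  WF-del : ∀ H i → WF Λ H → WF Λ (del Λ H i)
  WF-del (mkG vs es) i (uq , ends) = uq , All-removeAt ends i

  rename-∈ : ∀ {vs u v} t → u ∈ vs → (u ≡ᵇ v) ≡ false → t ∈ vs → rename v u t ∈ filt (λ a → not (a ≡ᵇ v)) vs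
  rename-∈ {vs} {u} {v} t um e tm with t ≡ᵇ v | ≡ᵇ-reflects t v
  ... | true  | _      = ∈-filt um (cong not e)
  ... | false | ofⁿ ne = ∈-filt tm (cong not (≡ᵇ-false ne))

  WF-contract : ∀ vs es u v → Unique vs → All (Endpoints∈ vs) es → u ∈ vs → ∀ isLoop → (u ≡ᵇ v) ≡ isLoop →
    WF Λ (if isLoop then mkG vs es else mkG (filt (λ a → not (a ≡ᵇ v)) vs) (mapList (renE Λ v u) es))
  WF-contract vs es u v uq ends um true  e = uq , ends
  WF-contract vs es u v uq ends um false e =
    Unique-filt uq , All-mapList (λ { {a , b , l} (am , bm) → rename-∈ a um e am , rename-∈ b um e bm }) ends

  WF-con : ∀ H i → WF Λ H → WF Λ (con Λ H i)
  WF-con (mkG vs es) i (uq , ends) =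
    WF-contract vs (removeAt es i) (proj₁ (lookup es i)) (proj₁ (proj₂ (lookup es i))) uq (All-removeAt ends i)
                (proj₁ (All-lookup ends i)) _ ≡.refl

  none-of-four : ∀ p q r s → not (p ∨ (q ∨ (r ∨ s))) ≡ true → (not (p ∨ q) ≡ true) × (not (r ∨ s) ≡ true)
  none-of-four false false false false e = ≡.refl , ≡.refl
  none-of-four true  q     r     s     ()
  none-of-four false true  r     s     ()
  none-of-four false false true  s     ()
  none-of-four false false false true  ()

  WF-dag : ∀ H i → WF Λ H → WF Λ (dag Λ H i)
  WF-dag (mkG vs es) i (uq , ends) =
    Unique-filt uq , All-filt-kept (removeAt es i) (All.map (λ {e} → survives {e}) (All-removeAt ends i))
    where
    u = proj₁ (lookup es i)
    v = proj₁ (proj₂ (lookup es i))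
    survives : ∀ {e} → Endpoints∈ vs e →
      (let (a , b , _) = e in not ((a ≡ᵇ u) ∨ (a ≡ᵇ v) ∨ (b ≡ᵇ u) ∨ (b ≡ᵇ v)) ≡ true) →
      Endpoints∈ (filt (λ a → not ((a ≡ᵇ u) ∨ (a ≡ᵇ v))) vs) e
    survives {a , b , _} (am , bm) k =
      ∈-filt am (proj₁ (none-of-four (a ≡ᵇ u) (a ≡ᵇ v) (b ≡ᵇ u) (b ≡ᵇ v) k)) ,
      ∈-filt bm (proj₂ (none-of-four (a ≡ᵇ u) (a ≡ᵇ v) (b ≡ᵇ u) (b ≡ᵇ v) k))

  NoCross : (ℕ → Bool) → List (Edge Λ) → Set
  NoCross p es = All (λ e → p (proj₁ e) ≡ p (proj₁ (proj₂ e))) es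

  WF-part : ∀ H (p : ℕ → Bool) → WF Λ H → NoCross p (edges H) → WF Λ (part Λ p H)
  WF-part (mkG vs es) p (uq , ends) nc = Unique-filt uq , All-filt-kept es (sideEnds ends nc)
    where
    sideEnds : ∀ {es} → All (Endpoints∈ vs) es → NoCross p es →
               All (λ e → p (proj₁ e) ≡ true → Endpoints∈ (filt p vs) e) es
    sideEnds []                 []          = []
    sideEnds ((am , bm) ∷ ends) (pab ∷ nc) = (λ k → ∈-filt am k , ∈-filt bm (≡.trans (≡.sym pab) k)) ∷ sideEnds ends nc

  complement-resp : ∀ {p q : ℕ → Bool} → (∀ a → q a ≡ not (p a)) → ∀ {a b} → p a ≡ p b → q a ≡ q b
  complement-resp {p} {q} q≡¬p {a} {b} e = ≡.trans (q≡¬p a) (≡.trans (cong not e) (≡.sym (q≡¬p b)))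

  power-+ : ∀ m n → power (m ℕ.+ n) ≈ power m * power n
  power-+ zero    n = sym (*-identityˡ (power n))
  power-+ (suc m) n = trans (*-cong refl (power-+ m n)) (sym (*-assoc x (power m) (power n)))

  -- Splitting a graph H along p, when its first edge uv lies on the p-side: the
  -- operations on uv commute with taking the p-part and leave the q-part alone.
  module FirstEdgeOnOneSide (vs : List ℕ) (u v : ℕ) (l : Λ) (L : List (Edge Λ)) (p q : ℕ → Bool)
                            (q≡¬p : ∀ a → q a ≡ not (p a)) (pu : p u ≡ true) (pv : p v ≡ true) (nc : NoCross p L) where

    H  = mkG vs ((u , v , l) ∷ L)
    Hp = mkG (filt p vs) ((u , v , l) ∷ filt (λ e → p (proj₁ e)) L)
    Hq = mkG (filt q vs) (filt (λ e → q (proj₁ e)) L)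

    qu : q u ≡ false
    qu = ≡.trans (q≡¬p u) (cong not pu)

    qv : q v ≡ false
    qv = ≡.trans (q≡¬p v) (cong not pv)

    part-p : part Λ p H ≡ Hp
    part-p = cong (mkG (filt p vs)) (filt-keep L pu)

    part-q : part Λ q H ≡ Hq
    part-q = cong (mkG (filt q vs)) (filt-drop L qu)

    -- the vertices on the q-side are neither u nor v, so no operation touches them
    q-not-u : ∀ {a} → q a ≡ true → ¬ (a ≡ u)
    q-not-u qa ≡.refl with ≡.trans (≡.sym qu) qa
    ... | ()

    q-not-v : ∀ {a} → q a ≡ true → ¬ (a ≡ v)
    q-not-v qa ≡.refl with ≡.trans (≡.sym qv) qa
    ... | ()

    p-rename : ∀ a → p (rename v u a) ≡ p a
    p-rename a with a ≡ᵇ v | ≡ᵇ-reflects a v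
    ... | true  | ofʸ ≡.refl = ≡.trans pu (≡.sym pv)
    ... | false | _          = ≡.refl

    q-rename : ∀ a → q (rename v u a) ≡ q a
    q-rename a = complement-resp q≡¬p (p-rename a)

    q-keeps : ∀ a → (not (a ≡ᵇ v) ∧ q a) ≡ q a
    q-keeps a with q a in qa
    ... | false = ∧-zeroʳ _
    ... | true rewrite ≡ᵇ-false (q-not-v qa) = ≡.refl

    q-keeps₂ : ∀ a → (not ((a ≡ᵇ u) ∨ (a ≡ᵇ v)) ∧ q a) ≡ q a
    q-keeps₂ a with q a in qa
    ... | false = ∧-zeroʳ _
    ... | true rewrite ≡ᵇ-false (q-not-u qa) | ≡ᵇ-false (q-not-v qa) = ≡.refl

    rename-q-edge : ∀ (e : Edge Λ) → p (proj₁ e) ≡ p (proj₁ (proj₂ e)) → q (proj₁ e) ≡ true → renE Λ v u e ≡ e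
    rename-q-edge (a , b , k) pab qa =
      cong₂ (λ s t → (s , t , k)) (rename-other (q-not-v qa)) (rename-other (q-not-v (≡.trans (≡.sym (complement-resp q≡¬p pab)) qa)))

    dag-keeps-q-edge : ∀ (e : Edge Λ) → p (proj₁ e) ≡ p (proj₁ (proj₂ e)) →
      (let (a , b , _) = e in (not ((a ≡ᵇ u) ∨ (a ≡ᵇ v) ∨ (b ≡ᵇ u) ∨ (b ≡ᵇ v)) ∧ q a)) ≡ q (proj₁ e)
    dag-keeps-q-edge (a , b , k) pab with q a in qa
    ... | false = ∧-zeroʳ _
    ... | true rewrite ≡ᵇ-false (q-not-u qa) | ≡ᵇ-false (q-not-v qa)
                     | ≡ᵇ-false (q-not-u (≡.trans (≡.sym (complement-resp q≡¬p pab)) qa))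
                     | ≡ᵇ-false (q-not-v (≡.trans (≡.sym (complement-resp q≡¬p pab)) qa)) = ≡.refl

    con-part-p : part Λ p (con Λ H zero) ≡ con Λ Hp zero
    con-part-p with u ≡ᵇ v
    ... | true  = ≡.refl
    ... | false = cong₂ mkG (filt-comm p (λ a → not (a ≡ᵇ v)) vs) (filt-mapList (λ e → p-rename (proj₁ e)) L)

    con-part-q : part Λ q (con Λ H zero) ≡ Hq
    con-part-q with u ≡ᵇ v
    ... | true  = ≡.refl
    ... | false = cong₂ mkG (≡.trans (filt-filt q (λ a → not (a ≡ᵇ v)) vs) (filt-ext q-keeps vs))
                            (≡.trans (filt-mapList (λ e → q-rename (proj₁ e)) L)
                                     (mapList-id _ (All-filt-kept L (All.map (λ {e} → rename-q-edge e) nc))))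

    con-noCross : NoCross p (edges (con Λ H zero))
    con-noCross with u ≡ᵇ v
    ... | true  = nc
    ... | false = All-mapList (λ {e} pab → ≡.trans (p-rename (proj₁ e)) (≡.trans pab (≡.sym (p-rename (proj₁ (proj₂ e)))))) nc

    con-length : length (edges (con Λ H zero)) ≡ length L
    con-length with u ≡ᵇ v
    ... | true  = ≡.refl
    ... | false = length-mapList L

    dag-part-p : part Λ p (dag Λ H zero) ≡ dag Λ Hp zero
    dag-part-p = cong₂ mkG (filt-comm p _ vs) (filt-comm _ _ L)

    dag-part-q : part Λ q (dag Λ H zero) ≡ Hq
    dag-part-q = cong₂ mkG (≡.trans (filt-filt q _ vs) (filt-ext q-keeps₂ vs))
                           (≡.trans (filt-filt _ _ L) (filt-cong L (All.map (λ {e} → dag-keeps-q-edge e) nc)))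

  SplitsMultiplicatively : ℕ → Set ℓ
  SplitsMultiplicatively k = ∀ H (p q : ℕ → Bool) → (∀ a → q a ≡ not (p a)) → length (edges H) < k →
    WF Λ H → NoCross p (edges H) → canonical H ≈ canonical (part Λ p H) * canonical (part Λ q H)

  distribʳ₃ : ∀ a b c A B C Q → (a * (A * Q) + b * (B * Q)) + c * (C * Q) ≈ ((a * A + b * B) + c * C) * Q
  distribʳ₃ = solve 7 (λ a b c A B C Q →
    (a :* (A :* Q) :+ b :* (B :* Q)) :+ c :* (C :* Q) := ((a :* A :+ b :* B) :+ c :* C) :* Q) refl

  -- one step of the induction: apply the recurrence to the first edge, which lies on the p-side
  split-first-edge : ∀ k vs u v l L (p q : ℕ → Bool) → (∀ a → q a ≡ not (p a)) → length L < k →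
    WF Λ (mkG vs ((u , v , l) ∷ L)) → p u ≡ p v → NoCross p L → p u ≡ true → SplitsMultiplicatively k →
    canonical (mkG vs ((u , v , l) ∷ L))
      ≈ canonical (part Λ p (mkG vs ((u , v , l) ∷ L))) * canonical (part Λ q (mkG vs ((u , v , l) ∷ L)))
  split-first-edge k vs u v l L p q q≡¬p lt wf puv nc pu IH = begin
      canonical H
    ≈⟨ canonical-first-edge vs u v l L wf ⟩
      (w l * canonical (del Λ H zero) + y l * canonical (con Λ H zero)) + z l * canonical (dag Λ H zero)
    ≈⟨ +-cong (+-cong (*-cong refl (splitVia (del Λ H zero) ≡.refl ≡.refl lt (WF-del H zero wf) nc))
                      (*-cong refl (splitVia (con Λ H zero) con-part-p con-part-q (≡.subst (_< k) (≡.sym con-length) lt)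
                                             (WF-con H zero wf) con-noCross)))
              (*-cong refl (splitVia (dag Λ H zero) dag-part-p dag-part-q (≤-trans (s≤s (length-filt L)) lt)
                                     (WF-dag H zero wf) (All-filt L nc))) ⟩
      (w l * (canonical (del Λ Hp zero) * canonical Hq) + y l * (canonical (con Λ Hp zero) * canonical Hq))
        + z l * (canonical (dag Λ Hp zero) * canonical Hq)
    ≈⟨ distribʳ₃ (w l) (y l) (z l) _ _ _ _ ⟩
      ((w l * canonical (del Λ Hp zero) + y l * canonical (con Λ Hp zero)) + z l * canonical (dag Λ Hp zero)) * canonical Hq
    ≈⟨ *-cong (sym (canonical-first-edge (filt p vs) u v l _ (≡.subst (WF Λ) part-p (WF-part H p wf (puv ∷ nc))))) refl ⟩
      canonical Hp * canonical Hq
    ≡⟨ cong₂ (λ A B → canonical A * canonical B) (≡.sym part-p) (≡.sym part-q) ⟩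
      canonical (part Λ p H) * canonical (part Λ q H)
    ∎
    where
    open import Relation.Binary.Reasoning.Setoid setoid
    open FirstEdgeOnOneSide vs u v l L p q q≡¬p pu (≡.trans (≡.sym puv) pu) nc
    splitVia : ∀ X {Y} → part Λ p X ≡ Y → part Λ q X ≡ Hq → length (edges X) < k → WF Λ X → NoCross p (edges X) →
               canonical X ≈ canonical Y * canonical Hq
    splitVia X ep eq lt' wf' nc' =
      trans (IH X p q q≡¬p lt' wf' nc') (reflexive (cong₂ (λ A B → canonical A * canonical B) ep eq))

  canonical-split : ∀ k → SplitsMultiplicatively k
  canonical-split zero H p q q≡¬p () wf nc
  canonical-split (suc k) (mkG vs []) p q q≡¬p _ wf nc =
    trans (reflexive (cong power (≡.sym (length-filt-split p q q≡¬p vs)))) (power-+ (length (filt p vs)) (length (filt q vs)))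
  canonical-split (suc k) (mkG vs ((u , v , l) ∷ L)) p q q≡¬p (s≤s lt) wf (puv ∷ nc) with true-or-false (p u)
  ... | inj₁ pu = split-first-edge k vs u v l L p q q≡¬p lt wf puv nc pu (canonical-split k)
  ... | inj₂ pu = trans (split-first-edge k vs u v l L q p p≡¬q lt wf (complement-resp q≡¬p puv)
                                          (All.map (complement-resp q≡¬p) nc)
                                          (≡.trans (q≡¬p u) (cong not pu)) (canonical-split k))
                        (*-comm _ _)
    where
    p≡¬q : ∀ a → p a ≡ not (q a)
    p≡¬q a = ≡.trans (≡.sym (not-involutive (p a))) (cong not (≡.sym (q≡¬p a)))

  module Soundness (Good : Λ → Set) (cond : Cond F w y z Good) where

    open Reorder Good cond
    open Eval F Λ w y z x
    open import Data.List.Relation.Binary.Permutation.Propositional using (↭-sym)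
    open import Data.List.Relation.Binary.Permutation.Propositional.Properties using (All-resp-↭)

    GoodGraph : MGraph Λ → Set
    GoodGraph H = All GoodEdge (edges H)

    -- the recurrence holds for every edge: move it to the front, which does not change ξ
    canonical-edge : ∀ H i → WF Λ H → GoodGraph H →
      let (_ , _ , l) = lookup (edges H) i in
      canonical H ≈ (w l * canonical (del Λ H i) + y l * canonical (con Λ H i)) + z l * canonical (dag Λ H i)
    canonical-edge (mkG vs es) i (uq , ends) good =
      trans (ξ-↭ (↭-sym toFront) good (length vs) (λ t → t) nothingDeleted)
            (canonical-first-edge vs _ _ _ (removeAt es i) (uq , All-resp-↭ (↭-sym toFront) ends))
      where toFront = lookup∷removeAt↭ es i

    GoodGraph-con : ∀ H i → GoodGraph H → GoodGraph (con Λ H i)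
    GoodGraph-con (mkG vs es) i good with proj₁ (lookup es i) ≡ᵇ proj₁ (proj₂ (lookup es i))
    ... | true  = All-removeAt good i
    ... | false = All-mapList (λ g → g) (All-removeAt good i)

    sound : ∀ {H r} → H ⇓ r → WF Λ H → GoodGraph H → r ≈ canonical H
    sound empty      wf good = refl
    sound (single v) wf good = sym (*-identityʳ x)
    sound (edge H i ⇓del ⇓con ⇓dag) wf good =
      trans (+-cong (+-cong (*-cong refl (sound ⇓del (WF-del H i wf) (All-removeAt good i)))
                            (*-cong refl (sound ⇓con (WF-con H i wf) (GoodGraph-con H i good))))
                    (*-cong refl (sound ⇓dag (WF-dag H i wf) (All-filt (removeAt (edges H) i) (All-removeAt good i)))))
            (sym (canonical-edge H i wf good))
    sound (union H p splits ⇓left ⇓right) wf good =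
      trans (*-cong (sound ⇓left (WF-part H p wf nc) (All-filt (edges H) good))
                    (sound ⇓right (WF-part H (λ v → not (p v)) wf (All.map (cong not) nc)) (All-filt (edges H) good)))
            (sym (canonical-split (suc (length (edges H))) H p (λ v → not (p v)) (λ _ → ≡.refl) ≤-refl wf nc))
      where nc = Splits.noCross splits

module Hypotheses {c ℓ} (F : Field c ℓ) (Λ : Set) (w y z : Λ → Field.Carrier F) (G : MGraph Λ) where

  open Field F using (_≈_; 0#; 1#; _*_)
  open import Data.List.Membership.Propositional using (_∈_)
  import Data.List.Relation.Unary.All as All
  open import Data.Product using (∃)
  open import Data.Sum using (inj₁; inj₂)
  open import Relation.Binary.PropositionalEquality using (_≡_; refl)

  label : Edge Λ → Λ
  label (_ , _ , l) = l

  Occurs : Λ → Set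
  Occurs l = ∃ λ e → e ∈ edges G × label e ≡ l

  occurring : All (λ e → Occurs (label e)) (edges G)
  occurring = All.tabulate (λ {e} m → e , m , refl)

  cond : ( All (λ { (_ , _ , l) → z l ≈ 0# }) (edges G)
         ⊎ ( All (λ { (_ , _ , l) → w l ≈ 1# }) (edges G)
           × All (λ { (_ , _ , l₁) → All (λ { (_ , _ , l₂) → y l₁ * z l₂ ≈ y l₂ * z l₁ }) (edges G) }) (edges G) ) ) →
         Cond F w y z Occurs
  cond (inj₁ z≈0)          = inj₁ (λ { l (e , m , refl) → All.lookup z≈0 m })
  cond (inj₂ (w≈1 , yz≈zy)) =
    inj₂ ( (λ { l (e , m , refl) → All.lookup w≈1 m })
         , (λ { l₁ l₂ (e₁ , m₁ , refl) (e₂ , m₂ , refl) → All.lookup (All.lookup yz≈zy m₁) m₂ }) )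

theorem3 : ∀ {c ℓ : Level} (F : Field c ℓ) (Λ : Set)
    (w y z : Λ → Field.Carrier F) (x : Field.Carrier F) (G : MGraph Λ) →
    WF Λ G →
    ( All (λ { (_ , _ , l) → Field._≈_ F (z l) (Field.0# F) }) (edges G)
    ⊎ ( All (λ { (_ , _ , l) → Field._≈_ F (w l) (Field.1# F) }) (edges G)
      × All (λ { (_ , _ , l₁) → All (λ { (_ , _ , l₂) →
              Field._≈_ F (Field._*_ F (y l₁) (z l₂)) (Field._*_ F (y l₂) (z l₁)) })
              (edges G) }) (edges G) ) ) →
    Eval.Confluent F Λ w y z x G
theorem3 F Λ w y z x G wf hyp ⇓a ⇓b = Field.trans F (sound ⇓a wf occurring) (Field.sym F (sound ⇓b wf occurring))
  where
  open Hypotheses F Λ w y z G using (Occurs; occurring; cond)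
  open Graphs.Soundness F Λ w y z x Occurs (cond hyp) using (sound)
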